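{- Fix $k\ge3$. Say a permutation $\pi=\pi_1\cdots\pi_m$ contains $\Lambda_k$ if there are indices $i_1<i_2<\cdots<i_k$ with $\pi_{i_k}>\pi_{i_j}$ for all $j<k$ (no condition on the relative order of $\pi_{i_1},\dots,\pi_{i_{k-1}}$), and avoids $\Lambda_k$ otherwise. Let $a(m)$ (resp. $b(m)$) be the number of $\Lambda_k$-avoiding up-down (resp. down-up) permutations of $\{1,\dots,m\}$. Then $a(m)=b(m)=E_m$ for $0\le m<k$, where $\sum_{m\ge0}E_m\frac{t^m}{m!}=\sec t+\tan t$, and whenever the index on the left-hand side is at least $k$, $$a(2n)=\sum_{i=1}^{\lfloor (k-1)/2\rfloor}(-1)^{i+1}\binom{k-1}{2i}a(2n-2i),\qquad a(2n+1)=\sum_{i=0}^{\lfloor (k-2)/2\rfloor}(-1)^{i}\binom{k-1}{2i+1}a(2n-2i),$$ $$b(2n)=\sum_{i=0}^{\lfloor (k-2)/2\rfloor}(-1)^{i}\binom{k-1}{2i+1}b(2n-2i-1),\qquad b(2n+1)=\sum_{i=1}^{\lfloor (k-1)/2\rfloor}(-1)^{i+1}\binom{k-1}{2i}b(2n-2i+1).$$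
   Context: Up-down: $\pi_1<\pi_2>\pi_3<\cdots$; down-up: $\pi_1>\pi_2<\pi_3>\cdots$. $\Lambda_k$ is the partially ordered pattern given by the flat poset on $\{1,\dots,k\}$ in which $k$ is greater than each of $1,\dots,k-1$ and $1,\dots,k-1$ are pairwise incomparable. By reverse/complement symmetry the same numbers count alternating permutations avoiding the other flat patterns (maximum or minimum element labeled $1$ or $k$). -}

module Defs where

open import Data.Nat using (ℕ; zero; suc; _<_; _<?_; _∸_; _*_; ⌊_/2⌋)
open import Data.Nat.Combinatorics using (_C_)
import Data.Nat as ℕ
open import Data.Integer using (ℤ; +_; _+_; -_; -1ℤ; 0ℤ; 1ℤ) renaming (_*_ to _*ℤ_; _^_ to _^ℤ_)
open import Data.List using (List; []; _∷_; [_]; _++_; map; concatMap; applyUpTo; length; filter; reverse)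
open import Data.List.Relation.Unary.All using (All; all?)
open import Data.List.Relation.Unary.Any using (Any; any?)
open import Data.List.Relation.Unary.Unique.Propositional using (Unique)
import Data.List.Relation.Unary.Unique.DecPropositional as UDec
open import Data.Product using (_×_; _,_)
open import Data.Empty using (⊥)
open import Data.Unit using (⊤; tt)
open import Relation.Nullary using (Dec; yes; no; ¬_; ¬?)
open import Relation.Nullary.Decidable using (_×-dec_)
open import Relation.Binary.PropositionalEquality using (_≡_)

words : ℕ → List ℕ → List (List ℕ)
words zero    L = [ [] ]
words (suc n) L = concatMap (λ x → map (x ∷_) (words n L)) L

oneTo : ℕ → List ℕ
oneTo = applyUpTo suc

-- A permutation of {1..m} (in one-line notation) is a length-m word over
-- {1..m} with pairwise distinct entries.  These are the words in
-- `words m (oneTo m)` satisfying `Unique`.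

mutual
  UpDown : List ℕ → Set
  UpDown []           = ⊤
  UpDown (x ∷ [])     = ⊤
  UpDown (x ∷ y ∷ ys) = (x < y) × DownUp (y ∷ ys)

  DownUp : List ℕ → Set
  DownUp []           = ⊤
  DownUp (x ∷ [])     = ⊤
  DownUp (x ∷ y ∷ ys) = (y < x) × UpDown (y ∷ ys)

mutual
  upDown? : (w : List ℕ) → Dec (UpDown w)
  upDown? []           = yes tt
  upDown? (x ∷ [])     = yes tt
  upDown? (x ∷ y ∷ ys) = (x <? y) ×-dec downUp? (y ∷ ys)

  downUp? : (w : List ℕ) → Dec (DownUp w)
  downUp? []           = yes tt
  downUp? (x ∷ [])     = yes tt
  downUp? (x ∷ y ∷ ys) = (y <? x) ×-dec upDown? (y ∷ ys)

subsequences : List ℕ → List (List ℕ)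
subsequences []       = [ [] ]
subsequences (x ∷ xs) = map (x ∷_) (subsequences xs) ++ subsequences xs

HeadDominates : List ℕ → Set
HeadDominates []         = ⊥
HeadDominates (x ∷ rest) = All (_< x) rest

headDominates? : (s : List ℕ) → Dec (HeadDominates s)
headDominates? []         = no (λ ())
headDominates? (x ∷ rest) = all? (_<? x) rest

LambdaOcc : ℕ → List ℕ → Set
LambdaOcc k s = (length s ≡ k) × HeadDominates (reverse s)

lambdaOcc? : (k : ℕ) → (s : List ℕ) → Dec (LambdaOcc k s)
lambdaOcc? k s = (length s ℕ.≟ k) ×-dec headDominates? (reverse s)

ContainsΛ : ℕ → List ℕ → Set
ContainsΛ k π = Any (LambdaOcc k) (subsequences π)

AvoidsΛ : ℕ → List ℕ → Set
AvoidsΛ k π = ¬ ContainsΛ k π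

avoidsΛ? : (k : ℕ) → (π : List ℕ) → Dec (AvoidsΛ k π)
avoidsΛ? k π = ¬? (any? (lambdaOcc? k) (subsequences π))

GoodUD : ℕ → List ℕ → Set
GoodUD k π = Unique π × UpDown π × AvoidsΛ k π

GoodDU : ℕ → List ℕ → Set
GoodDU k π = Unique π × DownUp π × AvoidsΛ k π

goodUD? : (k : ℕ) → (π : List ℕ) → Dec (GoodUD k π)
goodUD? k π = UDec.unique? ℕ._≟_ π ×-dec (upDown? π ×-dec avoidsΛ? k π)

goodDU? : (k : ℕ) → (π : List ℕ) → Dec (GoodDU k π)
goodDU? k π = UDec.unique? ℕ._≟_ π ×-dec (downUp? π ×-dec avoidsΛ? k π)

countUD : ℕ → ℕ → ℕ
countUD k m = length (filter (goodUD? k) (words m (oneTo m)))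

countDU : ℕ → ℕ → ℕ
countDU k m = length (filter (goodDU? k) (words m (oneTo m)))

-- Σ_{i=lo}^{hi} f i  (empty, i.e. 0, if hi < lo)
sumFromTo : ℕ → ℕ → (ℕ → ℤ) → ℤ
sumFromTo lo hi f = go (suc hi ∸ lo) lo
  where
  go : ℕ → ℕ → ℤ
  go zero    i = 0ℤ
  go (suc n) i = f i + go n (suc i)

sgn : ℕ → ℤ
sgn j = -1ℤ ^ℤ j

binom : ℕ → ℕ → ℤ
binom n r = + (n C r)

-- Euler numbers via  Σ_m E_m t^m / m! = sec t + tan t = (1 + sin t)/cos t.
-- As formal power series this is  cos t · F(t) = 1 + sin t; comparing
-- the coefficients of t^m/m! gives, for every m,
--   Σ_{j=0}^{⌊m/2⌋} (-1)^j C(m,2j) E_{m-2j} = [m = 0] + [m odd] (-1)^{(m-1)/2},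
-- which determines E uniquely (E_m appears with coefficient 1).

sinPlusOne : ℕ → ℤ
sinPlusOne zero          = 1ℤ
sinPlusOne (suc zero)    = 1ℤ
sinPlusOne (suc (suc m)) = sinCoeff m
  where
  -- coefficient (times (m+2)!) of t^(m+2) in 1 + sin t
  sinCoeff : ℕ → ℤ
  sinCoeff n with n ℕ.% 2
  ... | zero = 0ℤ
  ... | _    = - (sgn ⌊ n /2⌋)

IsSecTanEGF : (ℕ → ℤ) → Set
IsSecTanEGF E = ∀ m →
  sumFromTo 0 ⌊ m /2⌋ (λ j → sgn j *ℤ binom m (2 * j) *ℤ E (m ∸ 2 * j))
    ≡ sinPlusOne m

module Submission where

-- Write c_i for the number of entries left of π_i that are smaller than π_i. Then π avoids
-- Λ_k iff all c_i ≤ k − 2, and π_i < π_{i+1} iff c_i < c_{i+1}; deleting the last entry and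
-- standardising shows that Λ_k-avoiding alternating permutations are counted by alternating
-- codes with c_i < min(i, k − 1), i.e. by a transfer matrix on {0, …, k − 2}. Append to such
-- a code of length p a monotone run of length j and split by the type of the junction step:
-- the pairs for (p + 2, j) whose junction continues the code correspond to the pairs for
-- (p, j + 2) whose junction turns. Hence Σ_i (−1)^i a(p + 2i) r(j − 2i) telescopes to a
-- boundary term, where r(j) counts runs of length j. These are binomial coefficients:
-- C(k − 1, j) once all positions exceed k − 1, which gives the recurrences, and C(m, j) for
-- m < k, where the telescoped identity is the coefficient form of cos t (sec t + tan t) = 1 + sin t.

open import Data.Bool using (Bool; true; false; not; if_then_else_)
open import Data.Bool.Properties using (not-involutive)
open import Data.Nat
open import Data.Nat.Properties
open import Data.Nat.DivMod using (_%_; m*n%n≡0; [m+kn]%n≡m%n)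
open import Data.Nat.Induction using (<-rec)
open import Algebra.Properties.CommutativeSemigroup +-commutativeSemigroup using (interchange)
open import Data.Nat.Tactic.RingSolver using (solve-∀)
open import Data.Nat.Combinatorics using (_C_; nC1≡n; nCk+nC[k+1]≡[n+1]C[k+1]; k>n⇒nCk≡0)
open import Data.Integer using (ℤ; +_; -_; 0ℤ; 1ℤ) renaming (_+_ to _+ℤ_; _*_ to _*ℤ_)
import Data.Integer.Properties as ℤ
open import Algebra.Properties.AbelianGroup ℤ.+-0-abelianGroup using (∙-cancelʳ)
import Data.Integer.Tactic.RingSolver as ℤ-Solver
open import Defs
open import Data.List using (List; []; _∷_; [_]; _++_; map; concatMap; applyUpTo; length; filter; reverse; _∷ʳ_)
open import Data.List.Relation.Unary.All using (All; []; _∷_; all?)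
import Data.List.Relation.Unary.All as All
import Data.List.Relation.Unary.All.Properties as All
open import Data.List.Relation.Unary.AllPairs using ([]; _∷_)
open import Data.List.Relation.Unary.Unique.Propositional using (Unique)
import Data.List.Relation.Unary.Unique.Propositional.Properties as Unique
open import Data.List.Relation.Unary.Unique.DecPropositional _≟_ using (unique?)
open import Data.List.Properties using (filter-accept; filter-reject; filter-all; length-++; unfold-reverse; reverse-++; length-map; reverse-map; map-∘; map-++)
open import Data.List.Relation.Unary.Any using (Any; here; there)
import Data.List.Relation.Unary.Any as Any
import Data.List.Relation.Unary.Any.Properties as Any
open import Data.Product using (_×_; _,_)
open import Data.Product.Function.NonDependent.Propositional using (_×-⇔_)
open import Data.Sum using (_⊎_; inj₁; inj₂; [_,_]′)
open import Data.Sum.Function.Propositional using (_⊎-⇔_)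
open import Data.Unit using (⊤; tt)
open import Function using (_∘_)
open import Function.Bundles using (_⇔_; mk⇔; Equivalence)
open Equivalence using (to; from)
import Function.Properties.Equivalence as ⇔
open import Function.Properties.Inverse using (↔⇒⇔)
open import Relation.Nullary using (Dec; yes; no; does; ¬_; ¬?; contradiction)
open import Relation.Nullary.Decidable using (_×-dec_; dec-true; dec-false; does-⇔)
open import Relation.Binary.Definitions using (tri<; tri≈; tri>)
open import Relation.Binary.PropositionalEquality hiding ([_])

𝟙 : Bool → ℕ
𝟙 true  = 1
𝟙 false = 0

𝟙? : {P : Set} → Dec P → ℕ
𝟙? P? = 𝟙 (does P?)

𝟙?-yes : {P : Set} (P? : Dec P) → P → 𝟙? P? ≡ 1
𝟙?-yes P? p = cong 𝟙 (dec-true P? p)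

𝟙?-no : {P : Set} (P? : Dec P) → ¬ P → 𝟙? P? ≡ 0
𝟙?-no P? ¬p = cong 𝟙 (dec-false P? ¬p)

𝟙?-⇔ : {P Q : Set} → P ⇔ Q → (P? : Dec P) (Q? : Dec Q) → 𝟙? P? ≡ 𝟙? Q?
𝟙?-⇔ P⇔Q P? Q? = cong 𝟙 (does-⇔ P⇔Q P? Q?)

𝟙?-× : {P Q : Set} (P? : Dec P) (Q? : Dec Q) → 𝟙? (P? ×-dec Q?) ≡ 𝟙? P? * 𝟙? Q?
𝟙?-× P? Q? with does P?
... | true  = sym (+-identityʳ _)
... | false = refl

*-zeroˡ-≡ : ∀ {a b} → a ≡ 0 → a * b ≡ 0
*-zeroˡ-≡ refl = refl

*-zeroʳ-≡ : ∀ {a b} → b ≡ 0 → a * b ≡ 0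
*-zeroʳ-≡ {a} refl = *-zeroʳ a

*-identityˡ-≡ : ∀ {a b} → a ≡ 1 → a * b ≡ b
*-identityˡ-≡ refl = *-identityˡ _

Σℕ : ℕ → (ℕ → ℕ) → ℕ
Σℕ zero    f = 0
Σℕ (suc n) f = f 0 + Σℕ n (f ∘ suc)


Σℕ-cong : ∀ n {f g : ℕ → ℕ} → (∀ i → i < n → f i ≡ g i) → Σℕ n f ≡ Σℕ n g
Σℕ-cong zero    f≡g = refl
Σℕ-cong (suc n) f≡g = cong₂ _+_ (f≡g 0 z<s) (Σℕ-cong n (λ i i<n → f≡g (suc i) (s<s i<n)))

Σℕ-cong′ : ∀ n {f g : ℕ → ℕ} → (∀ i → f i ≡ g i) → Σℕ n f ≡ Σℕ n g
Σℕ-cong′ n f≡g = Σℕ-cong n (λ i _ → f≡g i)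

Σℕ-zeros : ∀ n {f : ℕ → ℕ} → (∀ i → f i ≡ 0) → Σℕ n f ≡ 0
Σℕ-zeros zero    f≡0 = refl
Σℕ-zeros (suc n) f≡0 = cong₂ _+_ (f≡0 0) (Σℕ-zeros n (f≡0 ∘ suc))

Σℕ-+ : ∀ n (f g : ℕ → ℕ) → Σℕ n (λ i → f i + g i) ≡ Σℕ n f + Σℕ n g
Σℕ-+ zero    f g = refl
Σℕ-+ (suc n) f g = trans (cong (_+_ (f 0 + g 0)) (Σℕ-+ n (f ∘ suc) (g ∘ suc))) (interchange (f 0) (g 0) _ _)

Σℕ-*ˡ : ∀ n c (f : ℕ → ℕ) → Σℕ n (λ i → c * f i) ≡ c * Σℕ n f
Σℕ-*ˡ zero    c f = sym (*-zeroʳ c)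
Σℕ-*ˡ (suc n) c f = trans (cong (_+_ (c * f 0)) (Σℕ-*ˡ n c (f ∘ suc))) (sym (*-distribˡ-+ c (f 0) _))

Σℕ-*ʳ : ∀ n c (f : ℕ → ℕ) → Σℕ n (λ i → f i * c) ≡ Σℕ n f * c
Σℕ-*ʳ n c f = begin
  Σℕ n (λ i → f i * c)  ≡⟨ Σℕ-cong′ n (λ i → *-comm (f i) c) ⟩
  Σℕ n (λ i → c * f i)  ≡⟨ Σℕ-*ˡ n c f ⟩
  c * Σℕ n f            ≡⟨ *-comm c _ ⟩
  Σℕ n f * c            ∎
  where open ≡-Reasoning

Σℕ-swap : ∀ n m (f : ℕ → ℕ → ℕ) → Σℕ n (λ i → Σℕ m (f i)) ≡ Σℕ m (λ j → Σℕ n (λ i → f i j))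
Σℕ-swap zero    m f = sym (Σℕ-zeros m (λ _ → refl))
Σℕ-swap (suc n) m f = begin
  Σℕ m (f 0) + Σℕ n (λ i → Σℕ m (f (suc i)))  ≡⟨ cong (_+_ (Σℕ m (f 0))) (Σℕ-swap n m (f ∘ suc)) ⟩
  Σℕ m (f 0) + Σℕ m (λ j → Σℕ n (λ i → f (suc i) j))  ≡⟨ Σℕ-+ m (f 0) _ ⟨
  Σℕ m (λ j → f 0 j + Σℕ n (λ i → f (suc i) j))  ∎
  where open ≡-Reasoning

Σℕ-last : ∀ n (f : ℕ → ℕ) → Σℕ (suc n) f ≡ Σℕ n f + f n
Σℕ-last zero    f = +-comm (f 0) 0
Σℕ-last (suc n) f = trans (cong (_+_ (f 0)) (Σℕ-last n (f ∘ suc))) (sym (+-assoc (f 0) _ _))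

Σℕ-truncate : ∀ {n m} (f : ℕ → ℕ) → n ≤ m → (∀ i → n ≤ i → f i ≡ 0) → Σℕ m f ≡ Σℕ n f
Σℕ-truncate {zero}  {m}     f _         f≡0 = Σℕ-zeros m (λ i → f≡0 i z≤n)
Σℕ-truncate {suc n} {suc m} f (s≤s n≤m) f≡0 = cong (_+_ (f 0)) (Σℕ-truncate (f ∘ suc) n≤m (λ i n≤i → f≡0 (suc i) (s≤s n≤i)))

Σℕ-range : ∀ {n m} (f : ℕ → ℕ) → (∀ i → n ≤ i → f i ≡ 0) → (∀ i → m ≤ i → f i ≡ 0) → Σℕ n f ≡ Σℕ m f
Σℕ-range {n} {m} f f≡0₁ f≡0₂ = trans (Σℕ-truncate f (m⊓n≤m n m) f≡0) (sym (Σℕ-truncate f (m⊓n≤n n m) f≡0))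
  where
  f≡0 : ∀ i → n ⊓ m ≤ i → f i ≡ 0
  f≡0 i n⊓m≤i with ⊓-sel n m
  ... | inj₁ n⊓m≡n = f≡0₁ i (subst (_≤ i) n⊓m≡n n⊓m≤i)
  ... | inj₂ n⊓m≡m = f≡0₂ i (subst (_≤ i) n⊓m≡m n⊓m≤i)

Σℕ-single : ∀ {n} k (f : ℕ → ℕ) → k < n → (∀ i → i ≢ k → f i ≡ 0) → Σℕ n f ≡ f k
Σℕ-single {suc n} zero    f _         f≡0 = trans (cong (_+_ (f 0)) (Σℕ-zeros n (λ i → f≡0 (suc i) (λ ())))) (+-identityʳ _)
Σℕ-single {suc n} (suc k) f (s<s k<n) f≡0 =
  trans (cong (_+ Σℕ n (f ∘ suc)) (f≡0 0 (λ ()))) (Σℕ-single k (f ∘ suc) k<n (λ i i≢k → f≡0 (suc i) (i≢k ∘ suc-injective)))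

Σℤ : ℕ → (ℕ → ℤ) → ℤ
Σℤ zero    f = 0ℤ
Σℤ (suc n) f = f 0 +ℤ Σℤ n (f ∘ suc)

Σℤ-cong : ∀ n {f g : ℕ → ℤ} → (∀ i → i < n → f i ≡ g i) → Σℤ n f ≡ Σℤ n g
Σℤ-cong zero    f≡g = refl
Σℤ-cong (suc n) f≡g = cong₂ _+ℤ_ (f≡g 0 z<s) (Σℤ-cong n (λ i i<n → f≡g (suc i) (s<s i<n)))

Σℤ-last : ∀ n (f : ℕ → ℤ) → Σℤ (suc n) f ≡ Σℤ n f +ℤ f n
Σℤ-last zero    f = trans (ℤ.+-identityʳ (f 0)) (sym (ℤ.+-identityˡ (f 0)))
Σℤ-last (suc n) f = trans (cong (f 0 +ℤ_) (Σℤ-last n (f ∘ suc))) (sym (ℤ.+-assoc (f 0) _ _))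

Σℤ-zeros : ∀ n {f : ℕ → ℤ} → (∀ i → f i ≡ 0ℤ) → Σℤ n f ≡ 0ℤ
Σℤ-zeros zero    f≡0 = refl
Σℤ-zeros (suc n) f≡0 = cong₂ _+ℤ_ (f≡0 0) (Σℤ-zeros n (f≡0 ∘ suc))

Σℤ-truncate : ∀ {n m} (f : ℕ → ℤ) → n ≤ m → (∀ i → n ≤ i → f i ≡ 0ℤ) → Σℤ m f ≡ Σℤ n f
Σℤ-truncate {zero}  {m}     f _         f≡0 = Σℤ-zeros m (λ i → f≡0 i z≤n)
Σℤ-truncate {suc n} {suc m} f (s≤s n≤m) f≡0 = cong (f 0 +ℤ_) (Σℤ-truncate (f ∘ suc) n≤m (λ i n≤i → f≡0 (suc i) (s≤s n≤i)))

Σℤ-neg : ∀ n (f : ℕ → ℤ) → - Σℤ n f ≡ Σℤ n (λ i → - f i)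
Σℤ-neg zero    f = refl
Σℤ-neg (suc n) f = trans (ℤ.neg-distrib-+ (f 0) _) (cong (- f 0 +ℤ_) (Σℤ-neg n (f ∘ suc)))

sumFromTo-peel : ∀ l h (f : ℕ → ℤ) → l ≤ h → sumFromTo l h f ≡ f l +ℤ sumFromTo (suc l) h f
sumFromTo-peel l h f l≤h rewrite +-∸-assoc 1 l≤h = refl

sumFromTo≡Σℤ : ∀ n l (f : ℕ → ℤ) → sumFromTo l (n + l) f ≡ Σℤ (suc n) (λ i → f (l + i))
sumFromTo≡Σℤ zero    l f = trans (sumFromTo-peel l l f ≤-refl) (cong₂ _+ℤ_ (cong f (sym (+-identityʳ l))) (empty (n<1+n l)))
  where
  empty : ∀ {h} → h < suc l → sumFromTo (suc l) h f ≡ 0ℤ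
  empty h<1+l rewrite m≤n⇒m∸n≡0 h<1+l = refl
sumFromTo≡Σℤ (suc n) l f = begin
    sumFromTo l (suc n + l) f
  ≡⟨ sumFromTo-peel l (suc n + l) f (m≤n+m l (suc n)) ⟩
    f l +ℤ sumFromTo (suc l) (suc n + l) f
  ≡⟨ cong₂ _+ℤ_ (cong f (sym (+-identityʳ l))) (cong (λ h → sumFromTo (suc l) h f) (sym (+-suc n l))) ⟩
    f (l + 0) +ℤ sumFromTo (suc l) (n + suc l) f
  ≡⟨ cong (f (l + 0) +ℤ_) (trans (sumFromTo≡Σℤ n (suc l) f) (Σℤ-cong (suc n) (λ i _ → cong f (sym (+-suc l i))))) ⟩
    f (l + 0) +ℤ Σℤ (suc n) (λ i → f (l + suc i))
  ∎
  where open ≡-Reasoning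

sumFromTo-0 : ∀ h (f : ℕ → ℤ) → sumFromTo 0 h f ≡ Σℤ (suc h) f
sumFromTo-0 h f = trans (cong (λ h′ → sumFromTo 0 h′ f) (sym (+-identityʳ h))) (sumFromTo≡Σℤ h 0 f)

sumFromTo-1 : ∀ h (f : ℕ → ℤ) → sumFromTo 1 h f ≡ Σℤ h (f ∘ suc)
sumFromTo-1 zero    f = refl
sumFromTo-1 (suc h) f = trans (cong (λ h′ → sumFromTo 1 h′ f) (+-comm 1 h)) (sumFromTo≡Σℤ h 1 f)

sumOver : {A : Set} → (A → ℕ) → List A → ℕ
sumOver f []       = 0
sumOver f (x ∷ xs) = f x + sumOver f xs

module _ {A : Set} where

  sumOver-cong : {f g : A → ℕ} (xs : List A) → (∀ x → f x ≡ g x) → sumOver f xs ≡ sumOver g xs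
  sumOver-cong []       f≡g = refl
  sumOver-cong (x ∷ xs) f≡g = cong₂ _+_ (f≡g x) (sumOver-cong xs f≡g)

  sumOver-cong-All : {P : A → Set} {f g : A → ℕ} (xs : List A) → All P xs → (∀ x → P x → f x ≡ g x) →
                     sumOver f xs ≡ sumOver g xs
  sumOver-cong-All []       []         f≡g = refl
  sumOver-cong-All (x ∷ xs) (px ∷ pxs) f≡g = cong₂ _+_ (f≡g x px) (sumOver-cong-All xs pxs f≡g)

  sumOver-zeros : {f : A → ℕ} (xs : List A) → (∀ x → f x ≡ 0) → sumOver f xs ≡ 0
  sumOver-zeros []       f≡0 = refl
  sumOver-zeros (x ∷ xs) f≡0 = cong₂ _+_ (f≡0 x) (sumOver-zeros xs f≡0)

  sumOver-++ : (f : A → ℕ) (xs ys : List A) → sumOver f (xs ++ ys) ≡ sumOver f xs + sumOver f ys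
  sumOver-++ f []       ys = refl
  sumOver-++ f (x ∷ xs) ys = trans (cong (_+_ (f x)) (sumOver-++ f xs ys)) (sym (+-assoc (f x) _ _))

  sumOver-+ : (f g : A → ℕ) (xs : List A) → sumOver (λ x → f x + g x) xs ≡ sumOver f xs + sumOver g xs
  sumOver-+ f g []       = refl
  sumOver-+ f g (x ∷ xs) = trans (cong (_+_ (f x + g x)) (sumOver-+ f g xs)) (interchange (f x) (g x) _ _)

  sumOver-*ˡ : (c : ℕ) (f : A → ℕ) (xs : List A) → sumOver (λ x → c * f x) xs ≡ c * sumOver f xs
  sumOver-*ˡ c f []       = sym (*-zeroʳ c)
  sumOver-*ˡ c f (x ∷ xs) = trans (cong (_+_ (c * f x)) (sumOver-*ˡ c f xs)) (sym (*-distribˡ-+ c (f x) _))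

  sumOver-*ʳ : (c : ℕ) (f : A → ℕ) (xs : List A) → sumOver (λ x → f x * c) xs ≡ sumOver f xs * c
  sumOver-*ʳ c f xs = trans (sumOver-cong xs (λ x → *-comm (f x) c)) (trans (sumOver-*ˡ c f xs) (*-comm c _))

  length-filter≡sumOver : {P : A → Set} (P? : ∀ x → Dec (P x)) (xs : List A) →
                          length (filter P? xs) ≡ sumOver (λ x → 𝟙? (P? x)) xs
  length-filter≡sumOver P? []       = refl
  length-filter≡sumOver P? (x ∷ xs) with does (P? x)
  ... | true  = cong suc (length-filter≡sumOver P? xs)
  ... | false = length-filter≡sumOver P? xs

  sumOver-filter : {P : A → Set} (P? : ∀ x → Dec (P x)) (h : A → ℕ) (xs : List A) →
                   sumOver (λ x → 𝟙? (P? x) * h x) xs ≡ sumOver h (filter P? xs)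
  sumOver-filter P? h []       = refl
  sumOver-filter P? h (x ∷ xs) with does (P? x)
  ... | true  = cong₂ _+_ (+-identityʳ (h x)) (sumOver-filter P? h xs)
  ... | false = sumOver-filter P? h xs

module _ {A B : Set} where

  sumOver-map : (f : B → ℕ) (g : A → B) (xs : List A) → sumOver f (map g xs) ≡ sumOver (f ∘ g) xs
  sumOver-map f g []       = refl
  sumOver-map f g (x ∷ xs) = cong (_+_ (f (g x))) (sumOver-map f g xs)

  sumOver-concatMap : (f : B → ℕ) (g : A → List B) (xs : List A) →
                      sumOver f (concatMap g xs) ≡ sumOver (sumOver f ∘ g) xs
  sumOver-concatMap f g []       = refl
  sumOver-concatMap f g (x ∷ xs) = trans (sumOver-++ f (g x) (concatMap g xs)) (cong (_+_ (sumOver f (g x))) (sumOver-concatMap f g xs))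

  sumOver-swap : (F : A → B → ℕ) (xs : List A) (ys : List B) →
                 sumOver (λ x → sumOver (F x) ys) xs ≡ sumOver (λ y → sumOver (λ x → F x y) xs) ys
  sumOver-swap F []       ys = sym (sumOver-zeros ys (λ _ → refl))
  sumOver-swap F (x ∷ xs) ys =
    trans (cong (_+_ (sumOver (F x) ys)) (sumOver-swap F xs ys)) (sym (sumOver-+ (F x) _ ys))

sumOver-applyUpTo : (h f : ℕ → ℕ) (n : ℕ) → sumOver h (applyUpTo f n) ≡ Σℕ n (h ∘ f)
sumOver-applyUpTo h f zero    = refl
sumOver-applyUpTo h f (suc n) = cong (_+_ (h (f 0))) (sumOver-applyUpTo h (f ∘ suc) n)

⌊2*n/2⌋≡n : ∀ n → ⌊ 2 * n /2⌋ ≡ n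
⌊2*n/2⌋≡n zero    = refl
⌊2*n/2⌋≡n (suc n) = trans (cong ⌊_/2⌋ (*-suc 2 n)) (cong suc (⌊2*n/2⌋≡n n))

⌊1+2*n/2⌋≡n : ∀ n → ⌊ suc (2 * n) /2⌋ ≡ n
⌊1+2*n/2⌋≡n zero    = refl
⌊1+2*n/2⌋≡n (suc n) = trans (cong (λ m → ⌊ suc m /2⌋) (*-suc 2 n)) (cong suc (⌊1+2*n/2⌋≡n n))

2*⌊n/2⌋≤n : ∀ n → 2 * ⌊ n /2⌋ ≤ n
2*⌊n/2⌋≤n zero          = z≤n
2*⌊n/2⌋≤n (suc zero)    = z≤n
2*⌊n/2⌋≤n (suc (suc n)) = subst (_≤ 2 + n) (sym (*-suc 2 ⌊ n /2⌋)) (s≤s (s≤s (2*⌊n/2⌋≤n n)))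

⌊n/2⌋<i⇒n<2*i : ∀ n i → ⌊ n /2⌋ < i → n < 2 * i
⌊n/2⌋<i⇒n<2*i zero          (suc i) _               = z<s
⌊n/2⌋<i⇒n<2*i (suc zero)    (suc i) _               = subst (1 <_) (sym (*-suc 2 i)) (s≤s (s≤s z≤n))
⌊n/2⌋<i⇒n<2*i (suc (suc n)) (suc i) (s≤s ⌊n/2⌋<i) = subst (2 + n <_) (sym (*-suc 2 i)) (s<s (s<s (⌊n/2⌋<i⇒n<2*i n i ⌊n/2⌋<i)))

data ParityView : ℕ → Set where
  even : ∀ M → ParityView (2 * M)
  odd  : ∀ M → ParityView (suc (2 * M))

parityView : ∀ m → ParityView m
parityView zero    = even 0
parityView (suc m) with parityView m
... | even M = odd M
... | odd  M = subst ParityView (*-suc 2 M) (even (suc M))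

2*[n∸i]≡2*n∸2*i : ∀ n i → 2 * (n ∸ i) ≡ 2 * n ∸ 2 * i
2*[n∸i]≡2*n∸2*i n i = *-distribˡ-∸ 2 n i

1+2*[n∸i]≡1+2*n∸2*i : ∀ n i → i ≤ n → suc (2 * (n ∸ i)) ≡ suc (2 * n) ∸ 2 * i
1+2*[n∸i]≡1+2*n∸2*i n i i≤n = trans (cong suc (2*[n∸i]≡2*n∸2*i n i)) (sym (+-∸-assoc 1 (*-monoʳ-≤ 2 i≤n)))

2+2*[n∸i]≤2*n : ∀ n i → 0 < 2 * i → i ≤ n → 2 + 2 * (n ∸ i) ≤ 2 * n
2+2*[n∸i]≤2*n n (suc i) _ 1+i≤n = subst (_≤ 2 * n) (*-suc 2 (n ∸ suc i))
  (*-monoʳ-≤ 2 (subst (_≤ n) (+-comm (n ∸ suc i) 1) (≤-trans (+-monoʳ-≤ (n ∸ suc i) (s≤s z≤n)) (≤-reflexive (m∸n+n≡m 1+i≤n)))))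

run-end-position : ∀ p j M i → i ≤ M → suc (p + 2 * (M ∸ i)) + (j + 2 * i) ∸ 1 ≡ p + j + 2 * M
run-end-position p j M i i≤M = trans (regroup p (2 * (M ∸ i)) j (2 * i))
                           (cong (_+_ (p + j)) (trans (sym (*-distribˡ-+ 2 (M ∸ i) i)) (cong (2 *_) (m∸n+n≡m i≤M))))
  where
  regroup : ∀ p x j y → p + x + (j + y) ≡ p + j + (x + y)
  regroup = solve-∀

sgn-suc : ∀ i → sgn (suc i) ≡ - sgn i
sgn-suc i = ℤ.-1*i≡-i (sgn i)

binom-0 : ∀ {n r} → n < r → binom n r ≡ 0ℤ
binom-0 n<r = cong +_ (k>n⇒nCk≡0 n<r)

x+s*0≡x : ∀ x s → x +ℤ s *ℤ 0ℤ ≡ x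
x+s*0≡x x s = trans (cong (x +ℤ_) (ℤ.*-zeroʳ s)) (ℤ.+-identityʳ x)

-- Codes and their transfer matrix

-- For c_i = #{j < i | π_j < π_i}: π_i < π_{i+1} iff c_i < c_{i+1}, and π_i > π_{i+1} iff c_{i+1} ≤ c_i.
CodeStep : Bool → ℕ → ℕ → Set
CodeStep true  y x = y < x
CodeStep false y x = x ≤ y

codeStep? : ∀ b y x → Dec (CodeStep b y x)
codeStep? true  y x = y <? x
codeStep? false y x = x ≤? y

step : Bool → ℕ → ℕ → ℕ
step b y x = 𝟙? (codeStep? b y x)

step-< : ∀ b {x y} → x < y → step b x y ≡ 𝟙 b
step-< true  {x} {y} x<y = 𝟙?-yes (x <? y) x<y
step-< false {x} {y} x<y = 𝟙?-no (y ≤? x) (<⇒≱ x<y)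

step-≥ : ∀ b {x y} → y ≤ x → step b x y ≡ 𝟙 (not b)
step-≥ true  {x} {y} y≤x = 𝟙?-no (x <? y) (≤⇒≯ y≤x)
step-≥ false {x} {y} y≤x = 𝟙?-yes (y ≤? x) y≤x

𝟙+𝟙-not : ∀ b → 𝟙 b + 𝟙 (not b) ≡ 1
𝟙+𝟙-not true  = refl
𝟙+𝟙-not false = refl

step-complement : ∀ b x y → step b x y + step (not b) x y ≡ 1
step-complement b x y with x <? y
... | yes x<y = trans (cong₂ _+_ (step-< b x<y) (step-< (not b) x<y)) (𝟙+𝟙-not b)
... | no  x≮y = trans (cong₂ _+_ (step-≥ b y≤x) (step-≥ (not b) y≤x)) (𝟙+𝟙-not (not b))
  where y≤x = ≮⇒≥ x≮y

module _ (N : ℕ) where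

  -- Functions supported on [0, N) serve as vectors: forward r o f is f pushed through the
  -- transfer matrix r and masked by o, backward does the same with the transpose of r, and
  -- pairing r f g = fᵀ r g.
  forward : (ℕ → ℕ → ℕ) → (ℕ → ℕ) → (ℕ → ℕ) → ℕ → ℕ
  forward r o f x = o x * Σℕ N (λ y → r y x * f y)

  backward : (ℕ → ℕ → ℕ) → (ℕ → ℕ) → (ℕ → ℕ) → ℕ → ℕ
  backward r o g x = o x * Σℕ N (λ y → r x y * g y)

  pairing : (ℕ → ℕ → ℕ) → (ℕ → ℕ) → (ℕ → ℕ) → ℕ
  pairing r f g = Σℕ N (λ x → Σℕ N (λ y → r x y * f x * g y))


  pairing-forward : ∀ r r′ o f g → pairing r′ (forward r o f) g ≡ pairing r f (backward r′ o g)
  pairing-forward r r′ o f g = begin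
      Σℕ N (λ x → Σℕ N (λ y → r′ x y * (o x * Σℕ N (λ w → r w x * f w)) * g y))
    ≡⟨ Σℕ-cong′ N (λ x → Σℕ-cong′ N (λ y → pull x y)) ⟩
      Σℕ N (λ x → Σℕ N (λ y → Σℕ N (λ w → r w x * f w * (o x * (r′ x y * g y)))))
    ≡⟨ Σℕ-cong′ N (λ x → Σℕ-swap N N _) ⟩
      Σℕ N (λ x → Σℕ N (λ w → Σℕ N (λ y → r w x * f w * (o x * (r′ x y * g y)))))
    ≡⟨ Σℕ-swap N N _ ⟩
      Σℕ N (λ w → Σℕ N (λ x → Σℕ N (λ y → r w x * f w * (o x * (r′ x y * g y)))))
    ≡⟨ Σℕ-cong′ N (λ w → Σℕ-cong′ N (λ x → push w x)) ⟩
      Σℕ N (λ w → Σℕ N (λ x → r w x * f w * (o x * Σℕ N (λ y → r′ x y * g y))))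
    ∎
    where
    open ≡-Reasoning
    reassoc : ∀ a b c d → a * (b * c) * d ≡ c * (b * (a * d))
    reassoc = solve-∀
    pull : ∀ x y → r′ x y * (o x * Σℕ N (λ w → r w x * f w)) * g y
                 ≡ Σℕ N (λ w → r w x * f w * (o x * (r′ x y * g y)))
    pull x y = trans (reassoc (r′ x y) (o x) _ (g y)) (sym (Σℕ-*ʳ N _ _))
    push : ∀ w x → Σℕ N (λ y → r w x * f w * (o x * (r′ x y * g y)))
                 ≡ r w x * f w * (o x * Σℕ N (λ y → r′ x y * g y))
    push w x = trans (Σℕ-*ˡ N (r w x * f w) _) (cong (r w x * f w *_) (Σℕ-*ˡ N (o x) _))

  Σ-forward : ∀ r o f → Σℕ N (forward r o f) ≡ pairing r f o
  Σ-forward r o f = begin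
      Σℕ N (λ x → o x * Σℕ N (λ w → r w x * f w))
    ≡⟨ Σℕ-cong′ N (λ x → Σℕ-*ˡ N (o x) _) ⟨
      Σℕ N (λ x → Σℕ N (λ w → o x * (r w x * f w)))
    ≡⟨ Σℕ-swap N N _ ⟩
      Σℕ N (λ w → Σℕ N (λ x → o x * (r w x * f w)))
    ≡⟨ Σℕ-cong′ N (λ w → Σℕ-cong′ N (λ x → rotate (o x) (r w x) (f w))) ⟩
      Σℕ N (λ w → Σℕ N (λ x → r w x * f w * o x))
    ∎
    where
    open ≡-Reasoning
    rotate : ∀ a b c → a * (b * c) ≡ b * c * a
    rotate = solve-∀

  pairing≡Σ-backward : ∀ r o g → pairing r o g ≡ Σℕ N (backward r o g)
  pairing≡Σ-backward r o g = Σℕ-cong′ N λ x →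
    trans (Σℕ-cong′ N (λ y → rotate (r x y) (o x) (g y))) (Σℕ-*ˡ N (o x) _)
    where
    rotate : ∀ a b c → a * b * c ≡ b * (a * c)
    rotate = solve-∀

  pairing-complement : ∀ r r′ f g → (∀ x y → r x y + r′ x y ≡ 1) →
                       pairing r f g + pairing r′ f g ≡ Σℕ N f * Σℕ N g
  pairing-complement r r′ f g r+r′≡1 = begin
      pairing r f g + pairing r′ f g
    ≡⟨ Σℕ-+ N _ _ ⟨
      Σℕ N (λ x → Σℕ N (λ y → r x y * f x * g y) + Σℕ N (λ y → r′ x y * f x * g y))
    ≡⟨ Σℕ-cong′ N (λ x → Σℕ-+ N _ _) ⟨
      Σℕ N (λ x → Σℕ N (λ y → r x y * f x * g y + r′ x y * f x * g y))
    ≡⟨ Σℕ-cong′ N (λ x → Σℕ-cong′ N (λ y → split x y)) ⟩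
      Σℕ N (λ x → Σℕ N (λ y → f x * g y))
    ≡⟨ Σℕ-cong′ N (λ x → Σℕ-*ˡ N (f x) g) ⟩
      Σℕ N (λ x → f x * Σℕ N g)
    ≡⟨ Σℕ-*ʳ N _ f ⟩
      Σℕ N f * Σℕ N g
    ∎
    where
    open ≡-Reasoning
    distrib : ∀ a b c d → a * c * d + b * c * d ≡ (a + b) * (c * d)
    distrib = solve-∀
    split : ∀ x y → r x y * f x * g y + r′ x y * f x * g y ≡ f x * g y
    split x y = trans (distrib (r x y) (r′ x y) (f x) (g y))
                      (trans (cong (_* (f x * g y)) (r+r′≡1 x y)) (*-identityˡ _))

  -- A code of length p is c₁ … c_p with c_i < min(i, N), i.e. allowed i c_i = 1. ending b p x
  -- counts those with alternating steps, the last one of type b, ending in x; runsFrom b q j y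
  -- counts runs c_q … c_{q+j} with c_q = y all of whose steps have type b.
  allowed : ℕ → ℕ → ℕ
  allowed q x = 𝟙? (x <? q) * 𝟙? (x <? N)

  ending : Bool → ℕ → ℕ → ℕ
  ending b zero          x = 0
  ending b (suc zero)      = allowed 1
  ending b (suc (suc p))   = forward (step b) (allowed (suc (suc p))) (ending (not b) (suc p))

  runsFrom : Bool → ℕ → ℕ → ℕ → ℕ
  runsFrom b q zero    = allowed q
  runsFrom b q (suc j) = backward (step b) (allowed q) (runsFrom b (suc q) j)

  codeCount : Bool → ℕ → ℕ
  codeCount b zero    = 1
  codeCount b (suc p) = Σℕ N (ending b (suc p))

  runCount : Bool → ℕ → ℕ → ℕ
  runCount b q zero    = 1
  runCount b q (suc j) = Σℕ N (runsFrom b q j)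

  -- Pairs (code of length p whose last step has type b, b-run on the positions p + 1 … p + j),
  -- split by whether the junction step has type b (straight) or not (turning). The conventions
  -- for p = 0 and j = 0 make straight-shift hold without exceptions.
  straight : Bool → ℕ → ℕ → ℕ
  straight b zero    j       = 0
  straight b (suc p) zero    = codeCount b (suc p)
  straight b (suc p) (suc j) = pairing (step b) (ending b (suc p)) (runsFrom b (suc (suc p)) j)

  turning : Bool → ℕ → ℕ → ℕ
  turning b zero    zero    = 1
  turning b zero    (suc j) = runCount b 1 (suc j)
  turning b (suc p) zero    = 0
  turning b (suc p) (suc j) = pairing (step (not b)) (ending b (suc p)) (runsFrom b (suc (suc p)) j)

  ending-not : ∀ b p → ending (not b) (suc (suc p)) ≡ forward (step (not b)) (allowed (suc (suc p))) (ending b (suc p))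
  ending-not true  p = refl
  ending-not false p = refl

  straight-shift : ∀ b p j → straight b (suc (suc p)) j ≡ turning b p (suc (suc j))
  straight-shift b zero zero =
    trans (Σ-forward (step b) (allowed 2) (allowed 1)) (pairing≡Σ-backward (step b) (allowed 1) (allowed 2))
  straight-shift b zero (suc j) =
    trans (pairing-forward (step b) (step b) (allowed 2) (allowed 1) (runsFrom b 3 j))
          (pairing≡Σ-backward (step b) (allowed 1) _)
  straight-shift b (suc p) zero = begin
      Σℕ N (forward (step b) (allowed (3 + p)) (ending (not b) (2 + p)))
    ≡⟨ Σ-forward (step b) _ _ ⟩
      pairing (step b) (ending (not b) (2 + p)) (allowed (3 + p))
    ≡⟨ cong (λ e → pairing (step b) e (allowed (3 + p))) (ending-not b p) ⟩
      pairing (step b) (forward (step (not b)) (allowed (2 + p)) (ending b (suc p))) (allowed (3 + p))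
    ≡⟨ pairing-forward (step (not b)) (step b) (allowed (2 + p)) (ending b (suc p)) (allowed (3 + p)) ⟩
      pairing (step (not b)) (ending b (suc p)) (runsFrom b (2 + p) 1)
    ∎
    where open ≡-Reasoning
  straight-shift b (suc p) (suc j) = begin
      pairing (step b) (forward (step b) (allowed (3 + p)) (ending (not b) (2 + p))) (runsFrom b (4 + p) j)
    ≡⟨ pairing-forward (step b) (step b) (allowed (3 + p)) (ending (not b) (2 + p)) (runsFrom b (4 + p) j) ⟩
      pairing (step b) (ending (not b) (2 + p)) (runsFrom b (3 + p) (suc j))
    ≡⟨ cong (λ e → pairing (step b) e (runsFrom b (3 + p) (suc j))) (ending-not b p) ⟩
      pairing (step b) (forward (step (not b)) (allowed (2 + p)) (ending b (suc p))) (runsFrom b (3 + p) (suc j))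
    ≡⟨ pairing-forward (step (not b)) (step b) (allowed (2 + p)) (ending b (suc p)) (runsFrom b (3 + p) (suc j)) ⟩
      pairing (step (not b)) (ending b (suc p)) (runsFrom b (2 + p) (2 + j))
    ∎
    where open ≡-Reasoning

  straight+turning : ∀ b p j → straight b p j + turning b p j ≡ codeCount b p * runCount b (suc p) j
  straight+turning b zero    zero    = refl
  straight+turning b zero    (suc j) = sym (+-identityʳ _)
  straight+turning b (suc p) zero    = trans (+-identityʳ _) (sym (*-identityʳ _))
  straight+turning b (suc p) (suc j) = pairing-complement (step b) (step (not b)) _ _ (step-complement b)

signed-telescope : ∀ M (X Y : ℕ → ℕ) → (∀ i → i < M → X i ≡ Y (suc i)) →
                   Σℤ (suc M) (λ i → sgn i *ℤ + (X i + Y i)) ≡ + Y 0 +ℤ sgn M *ℤ + X M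
signed-telescope zero X Y _ =
  trans (cong (λ z → 1ℤ *ℤ z +ℤ 0ℤ) (ℤ.pos-+ (X 0) (Y 0))) (base (+ X 0) (+ Y 0))
  where
  base : ∀ x y → 1ℤ *ℤ (x +ℤ y) +ℤ 0ℤ ≡ y +ℤ 1ℤ *ℤ x
  base = ℤ-Solver.solve-∀
signed-telescope (suc M) X Y X≡Y = begin
    Σℤ (2 + M) F
  ≡⟨ Σℤ-last (suc M) F ⟩
    Σℤ (suc M) F +ℤ F (suc M)
  ≡⟨ cong (_+ℤ F (suc M)) (signed-telescope M X Y (λ i i<M → X≡Y i (m<n⇒m<1+n i<M))) ⟩
    (+ Y 0 +ℤ sgn M *ℤ + X M) +ℤ sgn (suc M) *ℤ + (X (suc M) + Y (suc M))
  ≡⟨ cong₂ (λ u v → (+ Y 0 +ℤ sgn M *ℤ + u) +ℤ v *ℤ + (X (suc M) + Y (suc M))) (X≡Y M ≤-refl) (sgn-suc M) ⟩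
    (+ Y 0 +ℤ sgn M *ℤ + Y (suc M)) +ℤ (- sgn M) *ℤ + (X (suc M) + Y (suc M))
  ≡⟨ cong (λ z → (+ Y 0 +ℤ sgn M *ℤ + Y (suc M)) +ℤ (- sgn M) *ℤ z) (ℤ.pos-+ (X (suc M)) (Y (suc M))) ⟩
    (+ Y 0 +ℤ sgn M *ℤ + Y (suc M)) +ℤ (- sgn M) *ℤ (+ X (suc M) +ℤ + Y (suc M))
  ≡⟨ cancel (+ Y 0) (sgn M) (+ Y (suc M)) (+ X (suc M)) ⟩
    + Y 0 +ℤ (- sgn M) *ℤ + X (suc M)
  ≡⟨ cong (λ s → + Y 0 +ℤ s *ℤ + X (suc M)) (sgn-suc M) ⟨
    + Y 0 +ℤ sgn (suc M) *ℤ + X (suc M)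
  ∎
  where
  open ≡-Reasoning
  F : ℕ → ℤ
  F i = sgn i *ℤ + (X i + Y i)
  cancel : ∀ y₀ s a x → (y₀ +ℤ s *ℤ a) +ℤ (- s) *ℤ (x +ℤ a) ≡ y₀ +ℤ (- s) *ℤ x
  cancel = ℤ-Solver.solve-∀

signed-convolution : ∀ N b p j M →
  Σℤ (suc M) (λ i → sgn i *ℤ + (codeCount N b (p + 2 * (M ∸ i)) * runCount N b (suc (p + 2 * (M ∸ i))) (j + 2 * i)))
  ≡ + turning N b (p + 2 * M) j +ℤ sgn M *ℤ + straight N b p (j + 2 * M)
signed-convolution N b p j M = begin
    Σℤ (suc M) (λ i → sgn i *ℤ + (codeCount N b (p + 2 * (M ∸ i)) * runCount N b (suc (p + 2 * (M ∸ i))) (j + 2 * i)))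
  ≡⟨ Σℤ-cong (suc M) (λ i _ → cong (λ z → sgn i *ℤ + z) (straight+turning N b (p + 2 * (M ∸ i)) (j + 2 * i))) ⟨
    Σℤ (suc M) (λ i → sgn i *ℤ + (X i + Y i))
  ≡⟨ signed-telescope M X Y X≡Y ⟩
    + turning N b (p + 2 * M) (j + 0) +ℤ sgn M *ℤ + straight N b (p + 2 * (M ∸ M)) (j + 2 * M)
  ≡⟨ cong₂ (λ u v → + turning N b (p + 2 * M) u +ℤ sgn M *ℤ + straight N b v (j + 2 * M))
           (+-identityʳ j) (trans (cong (λ z → p + 2 * z) (n∸n≡0 M)) (+-identityʳ p)) ⟩
    + turning N b (p + 2 * M) j +ℤ sgn M *ℤ + straight N b p (j + 2 * M)
  ∎
  where
  open ≡-Reasoning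
  X Y : ℕ → ℕ
  X i = straight N b (p + 2 * (M ∸ i)) (j + 2 * i)
  Y i = turning  N b (p + 2 * (M ∸ i)) (j + 2 * i)
  +2*-suc : ∀ a c → a + 2 * suc c ≡ suc (suc (a + 2 * c))
  +2*-suc = solve-∀
  X≡Y : ∀ i → i < M → X i ≡ Y (suc i)
  X≡Y i i<M = begin
      straight N b (p + 2 * (M ∸ i)) (j + 2 * i)
    ≡⟨ cong (λ z → straight N b (p + 2 * z) (j + 2 * i)) (+-∸-assoc 1 i<M) ⟩
      straight N b (p + 2 * suc (M ∸ suc i)) (j + 2 * i)
    ≡⟨ cong (λ q → straight N b q (j + 2 * i)) (+2*-suc p (M ∸ suc i)) ⟩
      straight N b (suc (suc (p + 2 * (M ∸ suc i)))) (j + 2 * i)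
    ≡⟨ straight-shift N b (p + 2 * (M ∸ suc i)) (j + 2 * i) ⟩
      turning N b (p + 2 * (M ∸ suc i)) (suc (suc (j + 2 * i)))
    ≡⟨ cong (turning N b (p + 2 * (M ∸ suc i))) (+2*-suc j i) ⟨
      turning N b (p + 2 * (M ∸ suc i)) (j + 2 * suc i)
    ∎

module _ (N : ℕ) where

  allowed-yes : ∀ q {x} → x < q → x < N → allowed N q x ≡ 1
  allowed-yes q {x} x<q x<N = cong₂ _*_ (𝟙?-yes (x <? q) x<q) (𝟙?-yes (x <? N) x<N)

  allowed-≥q : ∀ q {x} → q ≤ x → allowed N q x ≡ 0
  allowed-≥q q {x} q≤x = *-zeroˡ-≡ (𝟙?-no (x <? q) (≤⇒≯ q≤x))

  allowed-≥N : ∀ q {x} → N ≤ x → allowed N q x ≡ 0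
  allowed-≥N q {x} N≤x = *-zeroʳ-≡ {𝟙? (x <? q)} (𝟙?-no (x <? N) (≤⇒≯ N≤x))

  allowed-*-cong : ∀ q x {a c} → (x < q → x < N → a ≡ c) → allowed N q x * a ≡ allowed N q x * c
  allowed-*-cong q x a≡c with x <? q | x <? N
  ... | yes x<q | yes x<N = cong (allowed N q x *_) (a≡c x<q x<N)
  ... | no  x≮q | _       = trans (*-zeroˡ-≡ (allowed-≥q q (≮⇒≥ x≮q))) (sym (*-zeroˡ-≡ (allowed-≥q q (≮⇒≥ x≮q))))
  ... | yes _   | no  x≮N = trans (*-zeroˡ-≡ (allowed-≥N q (≮⇒≥ x≮N))) (sym (*-zeroˡ-≡ (allowed-≥N q (≮⇒≥ x≮N))))

  runsFrom-≥q : ∀ b q j {y} → q ≤ y → runsFrom N b q j y ≡ 0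
  runsFrom-≥q b q zero    q≤y = allowed-≥q q q≤y
  runsFrom-≥q b q (suc j) q≤y = *-zeroˡ-≡ (allowed-≥q q q≤y)

  ending-≥N : ∀ b p {y} → N ≤ y → ending N b p y ≡ 0
  ending-≥N b zero          N≤y = refl
  ending-≥N b (suc zero)    N≤y = allowed-≥N 1 N≤y
  ending-≥N b (suc (suc p)) N≤y = *-zeroˡ-≡ (allowed-≥N (2 + p) N≤y)

  ending-≥p : ∀ b p {y} → p ≤ y → ending N b p y ≡ 0
  ending-≥p b zero          p≤y = refl
  ending-≥p b (suc zero)    p≤y = allowed-≥q 1 p≤y
  ending-≥p b (suc (suc p)) p≤y = *-zeroˡ-≡ (allowed-≥q (2 + p) p≤y)

  runsFrom-ascending-overflow : ∀ q j y → N ≤ y + j → runsFrom N true q j y ≡ 0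
  runsFrom-ascending-overflow q zero    y N≤y+0 = allowed-≥N q (subst (N ≤_) (+-identityʳ y) N≤y+0)
  runsFrom-ascending-overflow q (suc j) y N≤y+j = *-zeroʳ-≡ {allowed N q y} (Σℕ-zeros N vanish)
    where
    vanish : ∀ z → step true y z * runsFrom N true (suc q) j z ≡ 0
    vanish z with y <? z
    ... | yes y<z = *-zeroʳ-≡ {step true y z} (runsFrom-ascending-overflow (suc q) j z
                      (≤-trans N≤y+j (subst (_≤ z + j) (sym (+-suc y j)) (+-monoˡ-≤ j y<z))))
    ... | no  y≮z = *-zeroˡ-≡ (step-≥ true (≮⇒≥ y≮z))

  runsFrom-ascending-diagonal : ∀ q j → q + j < N → runsFrom N true (suc q) j q ≡ 1
  runsFrom-ascending-diagonal q zero    q+0<N = allowed-yes (suc q) (n<1+n q) (subst (_< N) (+-identityʳ q) q+0<N)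
  runsFrom-ascending-diagonal q (suc j) q+j<N = begin
      allowed N (suc q) q * Σℕ N (λ z → step true q z * runsFrom N true (2 + q) j z)
    ≡⟨ *-identityˡ-≡ (allowed-yes (suc q) (n<1+n q) (≤-trans (s≤s (m≤m+n q (suc j))) q+j<N)) ⟩
      Σℕ N (λ z → step true q z * runsFrom N true (2 + q) j z)
    ≡⟨ Σℕ-single (suc q) _ (≤-trans (s≤s (subst (suc q ≤_) (sym (+-suc q j)) (s≤s (m≤m+n q j)))) q+j<N) off-diagonal ⟩
      step true q (suc q) * runsFrom N true (2 + q) j (suc q)
    ≡⟨ *-identityˡ-≡ (step-< true (n<1+n q)) ⟩
      runsFrom N true (2 + q) j (suc q)
    ≡⟨ runsFrom-ascending-diagonal (suc q) j (subst (_< N) (+-suc q j) q+j<N) ⟩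
      1
    ∎
    where
    open ≡-Reasoning
    off-diagonal : ∀ z → z ≢ suc q → step true q z * runsFrom N true (2 + q) j z ≡ 0
    off-diagonal z z≢1+q with q <? z
    ... | yes q<z = *-zeroʳ-≡ {step true q z} (runsFrom-≥q true (2 + q) j (≤∧≢⇒< q<z (z≢1+q ∘ sym)))
    ... | no  q≮z = *-zeroˡ-≡ (step-≥ true (≮⇒≥ q≮z))

  runsFrom-descending-0 : ∀ q j → 0 < q → 0 < N → runsFrom N false q j 0 ≡ 1
  runsFrom-descending-0 q zero    0<q 0<N = allowed-yes q 0<q 0<N
  runsFrom-descending-0 q (suc j) 0<q 0<N = begin
      allowed N q 0 * Σℕ N (λ z → step false 0 z * runsFrom N false (suc q) j z)
    ≡⟨ *-identityˡ-≡ (allowed-yes q 0<q 0<N) ⟩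
      Σℕ N (λ z → step false 0 z * runsFrom N false (suc q) j z)
    ≡⟨ Σℕ-single 0 _ 0<N off-diagonal ⟩
      runsFrom N false (suc q) j 0 + 0
    ≡⟨ +-identityʳ _ ⟩
      runsFrom N false (suc q) j 0
    ≡⟨ runsFrom-descending-0 (suc q) j z<s 0<N ⟩
      1
    ∎
    where
    open ≡-Reasoning
    off-diagonal : ∀ z → z ≢ 0 → step false 0 z * runsFrom N false (suc q) j z ≡ 0
    off-diagonal zero    z≢0 = contradiction refl z≢0
    off-diagonal (suc z) _   = refl

-- Run counts

runsFrom-ascending-shift : ∀ N q j y → runsFrom (suc N) true (suc q) j (suc y) ≡ runsFrom N true q j y
runsFrom-ascending-shift N q zero    y = refl
runsFrom-ascending-shift N q (suc j) y =
  cong (allowed N q y *_) (Σℕ-cong′ N (λ z → cong (step true y z *_) (runsFrom-ascending-shift N (suc q) j z)))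

Σ-runsFrom-ascending : ∀ N q j → Σℕ N (runsFrom N true q j) ≡ (N ⊓ (q + j)) C (suc j)
Σ-runsFrom-ascending zero    q       j       = refl
Σ-runsFrom-ascending (suc N) zero    j       =
  trans (Σℕ-zeros (suc N) (λ y → runsFrom-≥q (suc N) true 0 j {y} z≤n)) (sym (k>n⇒nCk≡0 (s≤s (m⊓n≤n (suc N) j))))
Σ-runsFrom-ascending (suc N) (suc q) zero    = begin
    allowed (suc N) (suc q) 0 + Σℕ N (runsFrom (suc N) true (suc q) 0 ∘ suc)
  ≡⟨ cong suc (Σℕ-cong′ N (runsFrom-ascending-shift N q 0)) ⟩
    suc (Σℕ N (runsFrom N true q 0))
  ≡⟨ cong suc (trans (Σ-runsFrom-ascending N q 0) (nC1≡n (N ⊓ (q + 0)))) ⟩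
    suc (N ⊓ (q + 0))
  ≡⟨ nC1≡n (suc (N ⊓ (q + 0))) ⟨
    suc (N ⊓ (q + 0)) C 1
  ∎
  where open ≡-Reasoning
Σ-runsFrom-ascending (suc N) (suc q) (suc j) = begin
    runsFrom (suc N) true (suc q) (suc j) 0 + Σℕ N (runsFrom (suc N) true (suc q) (suc j) ∘ suc)
  ≡⟨ cong₂ _+_ starting-at-0 (Σℕ-cong′ N (runsFrom-ascending-shift N q (suc j))) ⟩
    Σℕ N (runsFrom N true (suc q) j) + Σℕ N (runsFrom N true q (suc j))
  ≡⟨ cong₂ _+_ (Σ-runsFrom-ascending N (suc q) j) (Σ-runsFrom-ascending N q (suc j)) ⟩
    (N ⊓ (suc q + j)) C (suc j) + (N ⊓ (q + suc j)) C (2 + j)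
  ≡⟨ cong (λ z → (N ⊓ z) C (suc j) + (N ⊓ (q + suc j)) C (2 + j)) (+-suc q j) ⟨
    (N ⊓ (q + suc j)) C (suc j) + (N ⊓ (q + suc j)) C (2 + j)
  ≡⟨ nCk+nC[k+1]≡[n+1]C[k+1] (N ⊓ (q + suc j)) (suc j) ⟩
    suc (N ⊓ (q + suc j)) C (2 + j)
  ∎
  where
  open ≡-Reasoning
  starting-at-0 : runsFrom (suc N) true (suc q) (suc j) 0 ≡ Σℕ N (runsFrom N true (suc q) j)
  starting-at-0 = trans (+-identityʳ _) (Σℕ-cong′ N (λ z → trans (+-identityʳ _) (runsFrom-ascending-shift N (suc q) j z)))

runCount-ascending : ∀ N q j → runCount N true q j ≡ (N ⊓ (q + j ∸ 1)) C j
runCount-ascending N q zero    = refl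
runCount-ascending N q (suc j) =
  trans (Σ-runsFrom-ascending N q j) (cong (λ z → (N ⊓ (z ∸ 1)) C suc j) (sym (+-suc q j)))

nonincreasing : ℕ → ℕ → ℕ
nonincreasing zero    y = 1
nonincreasing (suc j) y = Σℕ (suc y) (nonincreasing j)

Σ-nonincreasing : ∀ M j → Σℕ M (nonincreasing j) ≡ (M + j) C (suc j)
Σ-nonincreasing zero    j       = sym (k>n⇒nCk≡0 (n<1+n j))
Σ-nonincreasing (suc M) zero    =
  trans (cong suc (trans (Σ-nonincreasing M 0) (nC1≡n (M + 0)))) (sym (nC1≡n (suc (M + 0))))
Σ-nonincreasing (suc M) (suc j) = begin
    Σℕ (suc M) (nonincreasing (suc j))
  ≡⟨ Σℕ-last M (nonincreasing (suc j)) ⟩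
    Σℕ M (nonincreasing (suc j)) + Σℕ (suc M) (nonincreasing j)
  ≡⟨ cong₂ _+_ (Σ-nonincreasing M (suc j)) (Σ-nonincreasing (suc M) j) ⟩
    (M + suc j) C (2 + j) + (suc M + j) C (suc j)
  ≡⟨ cong (λ z → (M + suc j) C (2 + j) + z C (suc j)) (+-suc M j) ⟨
    (M + suc j) C (2 + j) + (M + suc j) C (suc j)
  ≡⟨ +-comm ((M + suc j) C (2 + j)) _ ⟩
    (M + suc j) C (suc j) + (M + suc j) C (2 + j)
  ≡⟨ nCk+nC[k+1]≡[n+1]C[k+1] (M + suc j) (suc j) ⟩
    suc (M + suc j) C (2 + j)
  ∎
  where open ≡-Reasoning

runsFrom-descending : ∀ N q j y → runsFrom N false q j y ≡ allowed N q y * nonincreasing j y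
runsFrom-descending N q zero    y = sym (*-identityʳ _)
runsFrom-descending N q (suc j) y = allowed-*-cong N q y below
  where
  below : y < q → y < N → Σℕ N (λ z → step false y z * runsFrom N false (suc q) j z) ≡ Σℕ (suc y) (nonincreasing j)
  below y<q y<N = trans
    (Σℕ-truncate _ y<N (λ z y<z → *-zeroˡ-≡ (step-< false y<z)))
    (Σℕ-cong (suc y) λ z z≤y → trans (*-identityˡ-≡ (step-≥ false (≤-pred z≤y)))
      (trans (runsFrom-descending N (suc q) j z)
             (*-identityˡ-≡ (allowed-yes N (suc q) (≤-trans z≤y (s≤s (<⇒≤ y<q))) (≤-trans z≤y y<N)))))

runCount-descending : ∀ N q j → runCount N false q (suc j) ≡ ((q ⊓ N) + j) C suc j
runCount-descending N q j = begin
    Σℕ N (runsFrom N false q j)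
  ≡⟨ Σℕ-cong′ N (runsFrom-descending N q j) ⟩
    Σℕ N (λ y → allowed N q y * nonincreasing j y)
  ≡⟨ Σℕ-truncate _ (m⊓n≤n q N) (λ y q⊓N≤y → *-zeroˡ-≡ (not-allowed y q⊓N≤y)) ⟩
    Σℕ (q ⊓ N) (λ y → allowed N q y * nonincreasing j y)
  ≡⟨ Σℕ-cong (q ⊓ N) (λ y y<q⊓N → *-identityˡ-≡ (allowed-yes N q (<-≤-trans y<q⊓N (m⊓n≤m q N)) (<-≤-trans y<q⊓N (m⊓n≤n q N)))) ⟩
    Σℕ (q ⊓ N) (nonincreasing j)
  ≡⟨ Σ-nonincreasing (q ⊓ N) j ⟩
    ((q ⊓ N) + j) C (suc j)
  ∎
  where
  open ≡-Reasoning
  not-allowed : ∀ y → q ⊓ N ≤ y → allowed N q y ≡ 0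
  not-allowed y q⊓N≤y with ⊓-sel q N
  ... | inj₁ q⊓N≡q = allowed-≥q N q (subst (_≤ y) q⊓N≡q q⊓N≤y)
  ... | inj₂ q⊓N≡N = allowed-≥N N q (subst (_≤ y) q⊓N≡N q⊓N≤y)

turning-1 : ∀ N b p → turning N b p 1 ≡ codeCount N (not b) (suc p)
turning-1 N b zero    = refl
turning-1 N b (suc p) = sym (trans (cong (Σℕ N) (ending-not N b p)) (Σ-forward N (step (not b)) (allowed N (2 + p)) (ending N b (suc p))))

pairing-allowed-1 : ∀ N r g → pairing N r (allowed N 1) g ≡ Σℕ N (λ y → r 0 y * g y)
pairing-allowed-1 zero    r g = refl
pairing-allowed-1 (suc N) r g =
  trans (cong₂ _+_ (Σℕ-cong′ (suc N) (λ y → cong (_* g y) (*-identityʳ (r 0 y))))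
                   (Σℕ-zeros N (λ x → Σℕ-zeros (suc N) (λ y → *-zeroˡ-≡ {b = g y} (*-zeroʳ (r (suc x) y))))))
        (+-identityʳ _)

codeCount-1 : ∀ N b → 0 < N → codeCount N b 1 ≡ 1
codeCount-1 N b 0<N = trans (Σℕ-single 0 (allowed N 1) 0<N off-diagonal) (allowed-yes N 1 z<s 0<N)
  where
  off-diagonal : ∀ x → x ≢ 0 → allowed N 1 x ≡ 0
  off-diagonal zero    x≢0 = contradiction refl x≢0
  off-diagonal (suc x) _   = allowed-≥q N 1 {suc x} (s≤s z≤n)

straight-ascending-1 : ∀ N j → j < N → straight N true 1 j ≡ 1
straight-ascending-1 N zero    0<N   = codeCount-1 N true 0<N
straight-ascending-1 N (suc j) 1+j<N = begin
    pairing N (step true) (allowed N 1) (runsFrom N true 2 j)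
  ≡⟨ pairing-allowed-1 N (step true) (runsFrom N true 2 j) ⟩
    Σℕ N (λ y → step true 0 y * runsFrom N true 2 j y)
  ≡⟨ Σℕ-single 1 _ (≤-trans (s≤s (s≤s z≤n)) 1+j<N) off-diagonal ⟩
    runsFrom N true 2 j 1 + 0
  ≡⟨ trans (+-identityʳ _) (runsFrom-ascending-diagonal N 1 j 1+j<N) ⟩
    1
  ∎
  where
  open ≡-Reasoning
  off-diagonal : ∀ y → y ≢ 1 → step true 0 y * runsFrom N true 2 j y ≡ 0
  off-diagonal zero          _   = refl
  off-diagonal (suc zero)    y≢1 = contradiction refl y≢1
  off-diagonal (suc (suc y)) _   = *-zeroʳ-≡ {1} (runsFrom-≥q N true 2 j (s≤s (s≤s z≤n)))

straight-ascending-1-overflow : ∀ N j → N ≤ suc j → straight N true 1 (suc j) ≡ 0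
straight-ascending-1-overflow N j N≤1+j =
  trans (pairing-allowed-1 N (step true) (runsFrom N true 2 j)) (Σℕ-zeros N vanish)
  where
  vanish : ∀ y → step true 0 y * runsFrom N true 2 j y ≡ 0
  vanish zero    = refl
  vanish (suc y) = *-zeroʳ-≡ {1} (runsFrom-ascending-overflow N 2 j (suc y) (≤-trans N≤1+j (s≤s (m≤n+m j y))))

straight-descending-1 : ∀ N j → 0 < N → straight N false 1 j ≡ 1
straight-descending-1 N zero    0<N = codeCount-1 N false 0<N
straight-descending-1 N (suc j) 0<N = begin
    pairing N (step false) (allowed N 1) (runsFrom N false 2 j)
  ≡⟨ pairing-allowed-1 N (step false) (runsFrom N false 2 j) ⟩
    Σℕ N (λ y → step false 0 y * runsFrom N false 2 j y)
  ≡⟨ Σℕ-single 0 _ 0<N off-diagonal ⟩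
    runsFrom N false 2 j 0 + 0
  ≡⟨ trans (+-identityʳ _) (runsFrom-descending-0 N 2 j z<s 0<N) ⟩
    1
  ∎
  where
  open ≡-Reasoning
  off-diagonal : ∀ y → y ≢ 0 → step false 0 y * runsFrom N false 2 j y ≡ 0
  off-diagonal zero    y≢0 = contradiction refl y≢0
  off-diagonal (suc y) _   = refl

module _ (K : ℕ) where

  runCount-descending-small : ∀ q r → (0 < r → q ≤ K) → runCount K false q r ≡ (q + r ∸ 1) C r
  runCount-descending-small q zero    _   = refl
  runCount-descending-small q (suc r) q≤K = trans (runCount-descending K q r)
    (cong (_C suc r) (trans (cong (_+ r) (m≤n⇒m⊓n≡m (q≤K z<s))) (cong (_∸ 1) (sym (+-suc q r)))))

  binomial-convolution : ∀ b p j M (e : ℕ → ℤ) (c : ℕ → ℕ) →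
    (∀ i → i ≤ M → + codeCount K b (p + 2 * (M ∸ i)) ≡ e i) →
    (∀ i → i ≤ M → runCount K b (suc (p + 2 * (M ∸ i))) (j + 2 * i) ≡ c i) →
    Σℤ (suc M) (λ i → sgn i *ℤ (+ c i *ℤ e i)) ≡ + turning K b (p + 2 * M) j +ℤ sgn M *ℤ + straight K b p (j + 2 * M)
  binomial-convolution b p j M e c code≡e run≡c =
    trans (Σℤ-cong (suc M) (λ i i≤M → cong (sgn i *ℤ_) (term i (≤-pred i≤M)))) (signed-convolution K b p j M)
    where
    term : ∀ i → i ≤ M → + c i *ℤ e i ≡ + (codeCount K b (p + 2 * (M ∸ i)) * runCount K b (suc (p + 2 * (M ∸ i))) (j + 2 * i))
    term i i≤M = begin
        + c i *ℤ e i
      ≡⟨ cong₂ (λ x y → + x *ℤ y) (run≡c i i≤M) (code≡e i i≤M) ⟨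
        + run *ℤ + code
      ≡⟨ ℤ.pos-* run code ⟨
        + (run * code)
      ≡⟨ cong +_ (*-comm run code) ⟩
        + (code * run)
      ∎
      where
      open ≡-Reasoning
      code = codeCount K b (p + 2 * (M ∸ i))
      run  = runCount K b (suc (p + 2 * (M ∸ i))) (j + 2 * i)

  runCount-ascending-run-end-position : ∀ p j M i → i ≤ M →
    runCount K true (suc (p + 2 * (M ∸ i))) (j + 2 * i) ≡ (K ⊓ (p + j + 2 * M)) C (j + 2 * i)
  runCount-ascending-run-end-position p j M i i≤M =
    trans (runCount-ascending K _ (j + 2 * i)) (cong (λ n → (K ⊓ n) C (j + 2 * i)) (run-end-position p j M i i≤M))

  runCount-descending-run-end-position : ∀ p j M i → i ≤ M → (0 < j + 2 * i → suc (p + 2 * (M ∸ i)) ≤ K) →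
    runCount K false (suc (p + 2 * (M ∸ i))) (j + 2 * i) ≡ (p + j + 2 * M) C (j + 2 * i)
  runCount-descending-run-end-position p j M i i≤M small =
    trans (runCount-descending-small _ (j + 2 * i) small) (cong (_C (j + 2 * i)) (run-end-position p j M i i≤M))

-- Permutations

sumOver-words-suc : (F : List ℕ → ℕ) (n : ℕ) (L : List ℕ) →
                    sumOver F (words (suc n) L) ≡ sumOver (λ x → sumOver (F ∘ (x ∷_)) (words n L)) L
sumOver-words-suc F n L = trans (sumOver-concatMap F (λ x → map (x ∷_) (words n L)) L)
                                (sumOver-cong L (λ x → sumOver-map F (x ∷_) (words n L)))

sumOver-words-∷ʳ : (F : List ℕ → ℕ) (n : ℕ) (L : List ℕ) →
                   sumOver F (words (suc n) L) ≡ sumOver (λ x → sumOver (λ w → F (w ∷ʳ x)) (words n L)) L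
sumOver-words-∷ʳ F zero    L = sumOver-words-suc F 0 L
sumOver-words-∷ʳ F (suc n) L = begin
    sumOver F (words (2 + n) L)
  ≡⟨ sumOver-words-suc F (suc n) L ⟩
    sumOver (λ y → sumOver (λ w → F (y ∷ w)) (words (suc n) L)) L
  ≡⟨ sumOver-cong L (λ y → sumOver-words-∷ʳ (λ w → F (y ∷ w)) n L) ⟩
    sumOver (λ y → sumOver (λ x → sumOver (λ w → F (y ∷ (w ∷ʳ x))) (words n L)) L) L
  ≡⟨ sumOver-swap (λ y x → sumOver (λ w → F (y ∷ (w ∷ʳ x))) (words n L)) L L ⟩
    sumOver (λ x → sumOver (λ y → sumOver (λ w → F (y ∷ (w ∷ʳ x))) (words n L)) L) L
  ≡⟨ sumOver-cong L (λ x → sumOver-words-suc (λ w → F (w ∷ʳ x)) n L) ⟨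
    sumOver (λ x → sumOver (λ w → F (w ∷ʳ x)) (words (suc n) L)) L
  ∎
  where open ≡-Reasoning

sumOver-words-map : (F : List ℕ → ℕ) (g : ℕ → ℕ) (n : ℕ) (L : List ℕ) →
                    sumOver F (words n (map g L)) ≡ sumOver (F ∘ map g) (words n L)
sumOver-words-map F g zero    L = refl
sumOver-words-map F g (suc n) L = begin
    sumOver F (words (suc n) (map g L))
  ≡⟨ sumOver-words-suc F n (map g L) ⟩
    sumOver (λ x → sumOver (F ∘ (x ∷_)) (words n (map g L))) (map g L)
  ≡⟨ sumOver-map _ g L ⟩
    sumOver (λ y → sumOver (F ∘ (g y ∷_)) (words n (map g L))) L
  ≡⟨ sumOver-cong L (λ y → sumOver-words-map (F ∘ (g y ∷_)) g n L) ⟩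
    sumOver (λ y → sumOver (λ u → F (g y ∷ map g u)) (words n L)) L
  ≡⟨ sumOver-words-suc (F ∘ map g) n L ⟨
    sumOver (F ∘ map g) (words (suc n) L)
  ∎
  where open ≡-Reasoning

sumOver-words-cong : (P : ℕ → Set) (n : ℕ) (L : List ℕ) → All P L → (F G : List ℕ → ℕ) →
                     (∀ u → length u ≡ n → All P u → F u ≡ G u) → sumOver F (words n L) ≡ sumOver G (words n L)
sumOver-words-cong P zero    L _   F G F≡G = cong (_+ 0) (F≡G [] refl [])
sumOver-words-cong P (suc n) L PL F G F≡G = begin
    sumOver F (words (suc n) L)
  ≡⟨ sumOver-words-suc F n L ⟩
    sumOver (λ x → sumOver (F ∘ (x ∷_)) (words n L)) L
  ≡⟨ sumOver-cong-All L PL (λ x px → sumOver-words-cong P n L PL (F ∘ (x ∷_)) (G ∘ (x ∷_))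
                                        (λ u len Pu → F≡G (x ∷ u) (cong suc len) (px ∷ Pu))) ⟩
    sumOver (λ x → sumOver (G ∘ (x ∷_)) (words n L)) L
  ≡⟨ sumOver-words-suc G n L ⟨
    sumOver G (words (suc n) L)
  ∎
  where open ≡-Reasoning

without : ℕ → List ℕ → List ℕ
without v = filter (λ y → ¬? (y ≟ v))

sumOver-words-without : (F : List ℕ → ℕ) (v n : ℕ) (L : List ℕ) →
  sumOver (λ w → 𝟙? (all? (λ y → ¬? (y ≟ v)) w) * F w) (words n L) ≡ sumOver F (words n (without v L))
sumOver-words-without F v zero    L = cong (_+ 0) (+-identityʳ (F []))
sumOver-words-without F v (suc n) L = begin
    sumOver (λ w → 𝟙? (all? y≢v? w) * F w) (words (suc n) L)
  ≡⟨ sumOver-words-suc _ n L ⟩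
    sumOver (λ y → sumOver (λ w → 𝟙? (y≢v? y ×-dec all? y≢v? w) * F (y ∷ w)) (words n L)) L
  ≡⟨ sumOver-cong L (λ y → trans (sumOver-cong (words n L) (λ w → split y w)) (sumOver-*ˡ (𝟙? (y≢v? y)) _ (words n L))) ⟩
    sumOver (λ y → 𝟙? (y≢v? y) * sumOver (λ w → 𝟙? (all? y≢v? w) * F (y ∷ w)) (words n L)) L
  ≡⟨ sumOver-cong L (λ y → cong (𝟙? (y≢v? y) *_) (sumOver-words-without (F ∘ (y ∷_)) v n L)) ⟩
    sumOver (λ y → 𝟙? (y≢v? y) * sumOver (F ∘ (y ∷_)) (words n (without v L))) L
  ≡⟨ sumOver-filter y≢v? _ L ⟩
    sumOver (λ y → sumOver (F ∘ (y ∷_)) (words n (without v L))) (without v L)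
  ≡⟨ sumOver-words-suc F n (without v L) ⟨
    sumOver F (words (suc n) (without v L))
  ∎
  where
  open ≡-Reasoning
  y≢v? : ∀ y → Dec (¬ y ≡ v)
  y≢v? y = ¬? (y ≟ v)
  split : ∀ y w → 𝟙? (y≢v? y ×-dec all? y≢v? w) * F (y ∷ w) ≡ 𝟙? (y≢v? y) * (𝟙? (all? y≢v? w) * F (y ∷ w))
  split y w = trans (cong (_* F (y ∷ w)) (𝟙?-× (y≢v? y) (all? y≢v? w))) (*-assoc (𝟙? (y≢v? y)) _ _)

range : ℕ → ℕ → List ℕ
range a zero    = []
range a (suc n) = a ∷ range (suc a) n

range-All : ∀ a n → All (λ y → a ≤ y × y < a + n) (range a n)
range-All a zero    = []
range-All a (suc n) = (≤-refl , subst (a <_) (sym (+-suc a n)) (s≤s (m≤m+n a n)))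
                    ∷ All.map (λ {y} (a<y , y<1+a+n) → <⇒≤ a<y , subst (y <_) (sym (+-suc a n)) y<1+a+n) (range-All (suc a) n)

oneTo≡range : ∀ n → oneTo n ≡ range 1 n
oneTo≡range n = applyUpTo≡range suc 1 n (λ _ → refl)
  where
  applyUpTo≡range : ∀ (f : ℕ → ℕ) a n → (∀ i → f i ≡ a + i) → applyUpTo f n ≡ range a n
  applyUpTo≡range f a zero    f≡a+ = refl
  applyUpTo≡range f a (suc n) f≡a+ = cong₂ _∷_ (trans (f≡a+ 0) (+-identityʳ a))
    (applyUpTo≡range (f ∘ suc) (suc a) n (λ i → trans (f≡a+ (suc i)) (+-suc a i)))

skip : ℕ → ℕ → ℕ
skip v y = if does (y <? v) then y else suc y

skip-< : ∀ {v y} → y < v → skip v y ≡ y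
skip-< {v} {y} y<v rewrite dec-true (y <? v) y<v = refl

skip-≥ : ∀ {v y} → v ≤ y → skip v y ≡ suc y
skip-≥ {v} {y} v≤y rewrite dec-false (y <? v) (≤⇒≯ v≤y) = refl

skip-mono : ∀ v {a b} → a < b → skip v a < skip v b
skip-mono v {a} {b} a<b with a <? v | b <? v
... | yes a<v | yes b<v = subst₂ _<_ (sym (skip-< a<v)) (sym (skip-< b<v)) a<b
... | yes a<v | no  b≮v = subst₂ _<_ (sym (skip-< a<v)) (sym (skip-≥ (≮⇒≥ b≮v))) (m<n⇒m<1+n a<b)
... | no  a≮v | yes b<v = contradiction (<-trans a<b b<v) a≮v
... | no  a≮v | no  b≮v = subst₂ _<_ (sym (skip-≥ (≮⇒≥ a≮v))) (sym (skip-≥ (≮⇒≥ b≮v))) (s<s a<b)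

skip-<-⇔ : ∀ v y → skip v y < v ⇔ y < v
skip-<-⇔ v y with y <? v
... | yes y<v = mk⇔ (λ _ → y<v) (λ _ → subst (_< v) (sym (skip-< y<v)) y<v)
... | no  y≮v = mk⇔ (λ 1+y<v → contradiction (<-trans (n<1+n y) (subst (_< v) (skip-≥ (≮⇒≥ y≮v)) 1+y<v)) y≮v)
                    (λ y<v → contradiction y<v y≮v)

without-range : ∀ v a n → a ≤ v → v ≤ a + n → without v (range a (suc n)) ≡ map (skip v) (range a n)
without-range v a zero    a≤v v≤a+0 =
  filter-reject (λ y → ¬? (y ≟ v)) (λ a≢v → a≢v (≤-antisym a≤v (subst (v ≤_) (+-identityʳ a) v≤a+0)))
without-range v a (suc n) a≤v v≤a+n with a ≟ v
... | yes refl = begin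
    without a (a ∷ range (suc a) (suc n))
  ≡⟨ filter-reject (λ y → ¬? (y ≟ a)) (λ a≢a → a≢a refl) ⟩
    without a (range (suc a) (suc n))
  ≡⟨ filter-all (λ y → ¬? (y ≟ a)) (All.map (λ (a<y , _) → >⇒≢ a<y) (range-All (suc a) (suc n))) ⟩
    range (suc a) (suc n)
  ≡⟨ map-skip-above a (suc n) ≤-refl ⟨
    map (skip a) (range a (suc n))
  ∎
  where
  open ≡-Reasoning
  map-skip-above : ∀ b n → a ≤ b → map (skip a) (range b n) ≡ range (suc b) n
  map-skip-above b zero    _   = refl
  map-skip-above b (suc n) a≤b = cong₂ _∷_ (skip-≥ a≤b) (map-skip-above (suc b) n (m≤n⇒m≤1+n a≤b))
... | no a≢v = trans (filter-accept (λ y → ¬? (y ≟ v)) a≢v)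
                     (cong₂ _∷_ (sym (skip-< a<v)) (without-range v (suc a) n a<v (subst (v ≤_) (+-suc a n) v≤a+n)))
  where a<v = ≤∧≢⇒< a≤v a≢v

countBelow : ℕ → List ℕ → ℕ
countBelow v = sumOver (λ a → 𝟙? (a <? v))

countBelow-skip : ∀ v u → countBelow v (map (skip v) u) ≡ countBelow v u
countBelow-skip v u = trans (sumOver-map _ (skip v) u) (sumOver-cong u (λ y → 𝟙?-⇔ (skip-<-⇔ v y) (skip v y <? v) (y <? v)))

length-filter+length-filter-¬ : {P : ℕ → Set} (P? : ∀ x → Dec (P x)) (xs : List ℕ) →
                                length (filter P? xs) + length (filter (¬? ∘ P?) xs) ≡ length xs
length-filter+length-filter-¬ P? []       = refl
length-filter+length-filter-¬ P? (x ∷ xs) with does (P? x)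
... | true  = cong suc (length-filter+length-filter-¬ P? xs)
... | false = trans (+-suc (length (filter P? xs)) _) (cong suc (length-filter+length-filter-¬ P? xs))

length≤1+length-without : ∀ b u → Unique u → length u ≤ suc (length (without b u))
length≤1+length-without b []       _              = z≤n
length≤1+length-without b (x ∷ xs) (x∉xs ∷ !xs) with x ≟ b
... | yes refl = s≤s (≤-reflexive (sym (trans (cong length (filter-reject (λ y → ¬? (y ≟ x)) (λ x≢x → x≢x refl)))
                                              (cong length (filter-all (λ y → ¬? (y ≟ x)) (All.map (λ x≢y y≡x → x≢y (sym y≡x)) x∉xs))))))
... | no  x≢b  = subst (λ l → suc (length xs) ≤ suc (length l)) (sym (filter-accept (λ y → ¬? (y ≟ b)) x≢b))
                       (s≤s (length≤1+length-without b xs !xs))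

length-unique-bounded : ∀ a b u → Unique u → All (λ y → a ≤ y × y < b) u → length u ≤ b ∸ a
length-unique-bounded a b       []       _  _                   = z≤n
length-unique-bounded a zero    (x ∷ u)  _  ((_ , ()) ∷ _)
length-unique-bounded a (suc b) (x ∷ u)  !u bounds@((a≤x , x≤b) ∷ _) = begin
    length (x ∷ u)
  ≤⟨ length≤1+length-without b (x ∷ u) !u ⟩
    suc (length (without b (x ∷ u)))
  ≤⟨ s≤s (length-unique-bounded a b (without b (x ∷ u)) (Unique.filter⁺ (λ y → ¬? (y ≟ b)) !u) bounds′) ⟩
    suc (b ∸ a)
  ≡⟨ +-∸-assoc 1 (≤-trans a≤x (≤-pred x≤b)) ⟨
    suc b ∸ a
  ∎
  where
  open ≤-Reasoning
  bounds′ : All (λ y → a ≤ y × y < b) (without b (x ∷ u))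
  bounds′ = All.zipWith (λ ((a≤y , y≤b) , y≢b) → a≤y , ≤∧≢⇒< (≤-pred y≤b) y≢b)
                        (All.filter⁺ (λ y → ¬? (y ≟ b)) bounds , All.all-filter (λ y → ¬? (y ≟ b)) (x ∷ u))

countBelow-permutation : ∀ n u x → Unique u → All (λ y → 1 ≤ y × y < suc n) u → length u ≡ n → x ≤ n →
                         countBelow (suc x) u ≡ x
countBelow-permutation n u x !u bounds len x≤n =
  ≤-antisym (subst (_≤ x) (length-filter≡sumOver below? u) #below≤x)
            (+-cancelʳ-≤ #above x (countBelow (suc x) u) x+#above≤#below+#above)
  where
  below? : ∀ y → Dec (y < suc x)
  below? y = y <? suc x
  #above = length (filter (¬? ∘ below?) u)
  #below≤x : length (filter below? u) ≤ x
  #below≤x = length-unique-bounded 1 (suc x) _ (Unique.filter⁺ below? !u)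
               (All.zipWith (λ ((1≤y , _) , y<1+x) → 1≤y , y<1+x) (All.filter⁺ below? bounds , All.all-filter below? u))
  #above≤n-x : #above ≤ n ∸ x
  #above≤n-x = length-unique-bounded (suc x) (suc n) _ (Unique.filter⁺ (¬? ∘ below?) !u)
                 (All.zipWith (λ ((_ , y<1+n) , y≮1+x) → ≮⇒≥ y≮1+x , y<1+n)
                              (All.filter⁺ (¬? ∘ below?) bounds , All.all-filter (¬? ∘ below?) u))
  x+#above≤#below+#above : x + #above ≤ countBelow (suc x) u + #above
  x+#above≤#below+#above = begin
      x + #above
    ≤⟨ +-monoʳ-≤ x #above≤n-x ⟩
      x + (n ∸ x)
    ≡⟨ m+[n∸m]≡n x≤n ⟩
      n
    ≡⟨ trans (sym len) (sym (length-filter+length-filter-¬ below? u)) ⟩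
      length (filter below? u) + #above
    ≡⟨ cong (_+ #above) (length-filter≡sumOver below? u) ⟩
      countBelow (suc x) u + #above
    ∎
    where open ≤-Reasoning

Step : Bool → ℕ → ℕ → Set
Step true  a c = a < c
Step false a c = c < a

step? : ∀ s a c → Dec (Step s a c)
step? true  a c = a <? c
step? false a c = c <? a

Alternating : Bool → List ℕ → Set
Alternating s []          = ⊤
Alternating s (x ∷ [])    = ⊤
Alternating s (x ∷ y ∷ r) = Step s x y × Alternating (not s) (y ∷ r)

alternating? : ∀ s π → Dec (Alternating s π)
alternating? s []          = yes tt
alternating? s (x ∷ [])    = yes tt
alternating? s (x ∷ y ∷ r) = step? s x y ×-dec alternating? (not s) (y ∷ r)

Alternating≡UpDown : ∀ π → Alternating true π ≡ UpDown π
Alternating≡DownUp : ∀ π → Alternating false π ≡ DownUp π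
Alternating≡UpDown []          = refl
Alternating≡UpDown (x ∷ [])    = refl
Alternating≡UpDown (x ∷ y ∷ r) = cong ((x < y) ×_) (Alternating≡DownUp (y ∷ r))
Alternating≡DownUp []          = refl
Alternating≡DownUp (x ∷ [])    = refl
Alternating≡DownUp (x ∷ y ∷ r) = cong ((y < x) ×_) (Alternating≡UpDown (y ∷ r))

-- The type of the step from the (n + 1)-st to the (n + 2)-nd entry, when the first step has type s.
stepAfter : Bool → ℕ → Bool
stepAfter s zero    = s
stepAfter s (suc n) = stepAfter (not s) n

stepAfter-suc : ∀ s n → stepAfter s n ≡ not (stepAfter s (suc n))
stepAfter-suc s zero    = sym (not-involutive s)
stepAfter-suc s (suc n) = stepAfter-suc (not s) n

stepAfter-even : ∀ s j → stepAfter s (2 * j) ≡ s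
stepAfter-even s zero    = refl
stepAfter-even s (suc j) = trans (cong (stepAfter s) (*-suc 2 j)) (trans (stepAfter-even (not (not s)) j) (not-involutive s))

lastEntry : List ℕ → ℕ
lastEntry []          = 0
lastEntry (x ∷ [])    = x
lastEntry (x ∷ y ∷ r) = lastEntry (y ∷ r)

lastEntry-∷ʳ : ∀ w v → lastEntry (w ∷ʳ v) ≡ v
lastEntry-∷ʳ []          v = refl
lastEntry-∷ʳ (x ∷ [])    v = refl
lastEntry-∷ʳ (x ∷ y ∷ w) v = lastEntry-∷ʳ (y ∷ w) v

lastEntry-map : ∀ g a r → lastEntry (map g (a ∷ r)) ≡ g (lastEntry (a ∷ r))
lastEntry-map g a []      = refl
lastEntry-map g a (b ∷ r) = lastEntry-map g b r

Alternating-∷ʳ : ∀ s a r v → Alternating s ((a ∷ r) ∷ʳ v) ⇔ (Alternating s (a ∷ r) × Step (stepAfter s (length r)) (lastEntry (a ∷ r)) v)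
Alternating-∷ʳ s a []      v = mk⇔ (λ (a~v , _) → tt , a~v) (λ (_ , a~v) → a~v , tt)
Alternating-∷ʳ s a (b ∷ r) v = mk⇔
  (λ (a~b , alt) → let (alt′ , b~v) = to (Alternating-∷ʳ (not s) b r v) alt in (a~b , alt′) , b~v)
  (λ ((a~b , alt′) , b~v) → a~b , from (Alternating-∷ʳ (not s) b r v) (alt′ , b~v))

Unique-∷ʳ : ∀ (w : List ℕ) v → Unique (w ∷ʳ v) ⇔ (All (λ y → ¬ y ≡ v) w × Unique w)
Unique-∷ʳ []      v = mk⇔ (λ _ → [] , []) (λ _ → [] ∷ [])
Unique-∷ʳ (x ∷ w) v = mk⇔
  (λ { (x∉w∷ʳv ∷ !w∷ʳv) → let (x∉w , x≢v) = All.∷ʳ⁻ x∉w∷ʳv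
                              (w∌v , !w) = to (Unique-∷ʳ w v) !w∷ʳv
                          in x≢v ∷ w∌v , x∉w ∷ !w })
  (λ { ((x≢v ∷ w∌v) , (x∉w ∷ !w)) → All.∷ʳ⁺ x∉w x≢v ∷ from (Unique-∷ʳ w v) (w∌v , !w) })

Any-⇔ : {P Q : List ℕ → Set} → (∀ {t} → P t ⇔ Q t) → ∀ {xs} → Any P xs ⇔ Any Q xs
Any-⇔ P⇔Q = mk⇔ (Any.map (to P⇔Q)) (Any.map (from P⇔Q))

All-reverse : ∀ {P : ℕ → Set} t → All P (reverse t) ⇔ All P t
All-reverse         []      = mk⇔ (λ _ → []) (λ _ → [])
All-reverse {P = P} (x ∷ t) = mk⇔
  (λ all → let (pt , px) = All.∷ʳ⁻ (subst (All P) (unfold-reverse x t) all) in px ∷ to (All-reverse t) pt)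
  (λ { (px ∷ pt) → subst (All P) (sym (unfold-reverse x t)) (All.∷ʳ⁺ (from (All-reverse t) pt) px) })

LambdaOcc-∷ʳ : ∀ K t v → LambdaOcc (suc K) (t ∷ʳ v) ⇔ (length t ≡ K × All (_< v) t)
LambdaOcc-∷ʳ K t v = mk⇔
  (λ (len , dom) → suc-injective (trans (sym length-∷ʳ) len) , to (All-reverse t) (subst HeadDominates (reverse-++ t [ v ]) dom))
  (λ (len , below) → trans length-∷ʳ (cong suc len) , subst HeadDominates (sym (reverse-++ t [ v ])) (from (All-reverse t) below))
  where
  length-∷ʳ : length (t ∷ʳ v) ≡ suc (length t)
  length-∷ʳ = trans (length-++ t) (+-comm (length t) 1)

Any-subsequences-∷ : ∀ (P : List ℕ → Set) a w →
  Any P (subsequences (a ∷ w)) ⇔ (Any (P ∘ (a ∷_)) (subsequences w) ⊎ Any P (subsequences w))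
Any-subsequences-∷ P a w = ⇔.trans (⇔.sym (↔⇒⇔ Any.++↔)) (⇔.sym (↔⇒⇔ Any.map↔) ⊎-⇔ ⇔.refl)

⊎-interchange : {A B C D : Set} → ((A ⊎ B) ⊎ (C ⊎ D)) ⇔ ((A ⊎ C) ⊎ (B ⊎ D))
⊎-interchange = mk⇔ interchange⊎ interchange⊎
  where
  interchange⊎ : {A B C D : Set} → (A ⊎ B) ⊎ (C ⊎ D) → (A ⊎ C) ⊎ (B ⊎ D)
  interchange⊎ = [ [ inj₁ ∘ inj₁ , inj₂ ∘ inj₁ ]′ , [ inj₁ ∘ inj₂ , inj₂ ∘ inj₂ ]′ ]′

Any-subsequences-∷ʳ : ∀ (P : List ℕ → Set) w v →
  Any P (subsequences (w ∷ʳ v)) ⇔ (Any P (subsequences w) ⊎ Any (P ∘ (_∷ʳ v)) (subsequences w))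
Any-subsequences-∷ʳ P []      v = mk⇔
  (λ { (here p) → inj₂ (here p) ; (there (here p)) → inj₁ (here p) })
  (λ { (inj₁ (here p)) → there (here p) ; (inj₂ (here p)) → here p })
Any-subsequences-∷ʳ P (a ∷ w) v =
  ⇔.trans (Any-subsequences-∷ P a (w ∷ʳ v))
  (⇔.trans (Any-subsequences-∷ʳ (P ∘ (a ∷_)) w v ⊎-⇔ Any-subsequences-∷ʳ P w v)
  (⇔.trans ⊎-interchange
           (⇔.sym (Any-subsequences-∷ P a w) ⊎-⇔ ⇔.sym (Any-subsequences-∷ (P ∘ (_∷ʳ v)) a w))))

BelowOfLength : ℕ → ℕ → List ℕ → Set
BelowOfLength K v t = length t ≡ K × All (_< v) t

below-subsequence⇒≤ : ∀ K v w → Any (BelowOfLength K v) (subsequences w) → K ≤ countBelow v w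
below-subsequence⇒≤ K       v []      (here (refl , _)) = z≤n
below-subsequence⇒≤ zero    v (a ∷ w) _                 = z≤n
below-subsequence⇒≤ (suc K) v (a ∷ w) occ with Any.++⁻ (map (a ∷_) (subsequences w)) occ
... | inj₂ occ′ = ≤-trans (below-subsequence⇒≤ (suc K) v w occ′) (m≤n+m _ (𝟙? (a <? v)))
... | inj₁ occ′ with Any.map⁻ occ′
...   | occ″ with (_ , (_ , (a<v ∷ _))) ← Any.satisfied occ″ =
  subst (λ c → suc K ≤ c + countBelow v w) (sym (𝟙?-yes (a <? v) a<v))
        (s≤s (below-subsequence⇒≤ K v w (Any.map (λ { (len , _ ∷ below) → suc-injective len , below }) occ″)))

≤⇒below-subsequence : ∀ K v w → K ≤ countBelow v w → Any (BelowOfLength K v) (subsequences w)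
≤⇒below-subsequence zero    v []      z≤n = here (refl , [])
≤⇒below-subsequence zero    v (a ∷ w) _   = Any.++⁺ʳ (map (a ∷_) (subsequences w)) (≤⇒below-subsequence zero v w z≤n)
≤⇒below-subsequence (suc K) v (a ∷ w) K<c with a <? v
... | yes a<v = Any.++⁺ˡ (Any.map⁺ (Any.map (λ (len , below) → cong suc len , a<v ∷ below)
                  (≤⇒below-subsequence K v w (≤-pred (subst (λ c → suc K ≤ c + countBelow v w) (𝟙?-yes (a <? v) a<v) K<c)))))
... | no  a≮v = Any.++⁺ʳ (map (a ∷_) (subsequences w))
                  (≤⇒below-subsequence (suc K) v w (subst (λ c → suc K ≤ c + countBelow v w) (𝟙?-no (a <? v) a≮v) K<c))

ContainsΛ-∷ʳ : ∀ K w v → ContainsΛ (suc K) (w ∷ʳ v) ⇔ (ContainsΛ (suc K) w ⊎ K ≤ countBelow v w)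
ContainsΛ-∷ʳ K w v = ⇔.trans (Any-subsequences-∷ʳ (LambdaOcc (suc K)) w v)
  (⇔.refl ⊎-⇔ ⇔.trans (Any-⇔ (λ {t} → LambdaOcc-∷ʳ K t v)) (mk⇔ (below-subsequence⇒≤ K v w) (≤⇒below-subsequence K v w)))

AvoidsΛ-∷ʳ : ∀ K w v → AvoidsΛ (suc K) (w ∷ʳ v) ⇔ (AvoidsΛ (suc K) w × countBelow v w < K)
AvoidsΛ-∷ʳ K w v = mk⇔
  (λ avoids → avoids ∘ from (ContainsΛ-∷ʳ K w v) ∘ inj₁ , ≰⇒> (avoids ∘ from (ContainsΛ-∷ʳ K w v) ∘ inj₂))
  (λ (avoids , c<K) → [ avoids , <⇒≱ c<K ]′ ∘ to (ContainsΛ-∷ʳ K w v))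

subsequences-map : ∀ (g : ℕ → ℕ) u → subsequences (map g u) ≡ map (map g) (subsequences u)
subsequences-map g []      = refl
subsequences-map g (x ∷ u) = begin
    map (g x ∷_) (subsequences (map g u)) ++ subsequences (map g u)
  ≡⟨ cong (λ z → map (g x ∷_) z ++ z) (subsequences-map g u) ⟩
    map (g x ∷_) (map (map g) (subsequences u)) ++ map (map g) (subsequences u)
  ≡⟨ cong (_++ map (map g) (subsequences u)) (trans (sym (map-∘ (subsequences u))) (map-∘ (subsequences u))) ⟩
    map (map g) (map (x ∷_) (subsequences u)) ++ map (map g) (subsequences u)
  ≡⟨ map-++ (map g) (map (x ∷_) (subsequences u)) (subsequences u) ⟨
    map (map g) (map (x ∷_) (subsequences u) ++ subsequences u)
  ∎
  where open ≡-Reasoning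

module Monotone (g : ℕ → ℕ) (g-mono : ∀ {a b} → a < b → g a < g b) where

  g-reflects-< : ∀ {a b} → g a < g b → a < b
  g-reflects-< {a} {b} ga<gb with <-cmp a b
  ... | tri< a<b _ _ = a<b
  ... | tri≈ _ refl _ = contradiction ga<gb (<-irrefl refl)
  ... | tri> _ _ b<a = contradiction ga<gb (<-asym (g-mono b<a))

  g-injective : ∀ {a b} → g a ≡ g b → a ≡ b
  g-injective {a} {b} ga≡gb with <-cmp a b
  ... | tri< a<b _ _ = contradiction ga≡gb (<⇒≢ (g-mono a<b))
  ... | tri≈ _ a≡b _ = a≡b
  ... | tri> _ _ b<a = contradiction (sym ga≡gb) (<⇒≢ (g-mono b<a))

  Unique-map : ∀ u → Unique (map g u) ⇔ Unique u
  Unique-map u = mk⇔ Unique.map⁻ (Unique.map⁺ g-injective)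

  Step-map : ∀ s a c → Step s (g a) (g c) ⇔ Step s a c
  Step-map true  a c = mk⇔ g-reflects-< g-mono
  Step-map false a c = mk⇔ g-reflects-< g-mono

  Alternating-map : ∀ s u → Alternating s (map g u) ⇔ Alternating s u
  Alternating-map s []          = ⇔.refl
  Alternating-map s (x ∷ [])    = ⇔.refl
  Alternating-map s (a ∷ b ∷ r) = Step-map s a b ×-⇔ Alternating-map (not s) (b ∷ r)

  HeadDominates-map : ∀ r → HeadDominates (map g r) ⇔ HeadDominates r
  HeadDominates-map []      = mk⇔ (λ ()) (λ ())
  HeadDominates-map (x ∷ r) = mk⇔ (All.map g-reflects-< ∘ All.map⁻) (All.map⁺ ∘ All.map g-mono)

  LambdaOcc-map : ∀ k t → LambdaOcc k (map g t) ⇔ LambdaOcc k t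
  LambdaOcc-map k t = mk⇔
    (λ (len , dom) → trans (sym (length-map g t)) len , to (HeadDominates-map (reverse t)) (subst HeadDominates (sym (reverse-map g t)) dom))
    (λ (len , dom) → trans (length-map g t) len , subst HeadDominates (reverse-map g t) (from (HeadDominates-map (reverse t)) dom))

  ContainsΛ-map : ∀ k u → ContainsΛ k (map g u) ⇔ ContainsΛ k u
  ContainsΛ-map k u =
    ⇔.trans (mk⇔ (subst (Any (LambdaOcc k)) (subsequences-map g u)) (subst (Any (LambdaOcc k)) (sym (subsequences-map g u))))
    (⇔.trans (⇔.sym (↔⇒⇔ Any.map↔)) (Any-⇔ (λ {t} → LambdaOcc-map k t)))

Step-skip : ∀ b y v → Step b (skip v y) v ⇔ CodeStep b y v
Step-skip true  y v = skip-<-⇔ v y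
Step-skip false y v with y <? v
... | yes y<v = mk⇔ (λ v<y′ → contradiction (subst (v <_) (skip-< y<v) v<y′) (<-asym y<v)) (λ v≤y → contradiction v≤y (<⇒≱ y<v))
... | no  y≮v = mk⇔ (λ _ → ≮⇒≥ y≮v) (λ v≤y → subst (v <_) (sym (skip-≥ v≤y)) (s≤s v≤y))

step-suc : ∀ b i x → 𝟙? (codeStep? b (suc i) (suc x)) ≡ step b i x
step-suc true  i x = refl
step-suc false i x = 𝟙?-⇔ (mk⇔ ≤-pred s≤s) (suc x ≤? suc i) (x ≤? i)

module _ (K : ℕ) where

  Good : Bool → List ℕ → Set
  Good s π = Unique π × Alternating s π × AvoidsΛ (suc K) π

  good? : ∀ s π → Dec (Good s π)
  good? s π = unique? π ×-dec (alternating? s π ×-dec avoidsΛ? (suc K) π)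

  count : Bool → ℕ → ℕ
  count s n = sumOver (𝟙? ∘ good? s) (words n (oneTo n))

  countEndingAt : Bool → ℕ → ℕ → ℕ
  countEndingAt s m v = sumOver (λ w → 𝟙? (good? s (w ∷ʳ v))) (words m (oneTo (suc m)))

  count-suc : ∀ s m → count s (suc m) ≡ Σℕ (suc m) (countEndingAt s m ∘ suc)
  count-suc s m = trans (sumOver-words-∷ʳ (𝟙? ∘ good? s) m (oneTo (suc m))) (sumOver-applyUpTo (countEndingAt s m) suc (suc m))

  Prefix : Bool → ℕ → ℕ → List ℕ → Set
  Prefix s m v w = Unique w × Alternating s w × Step (stepAfter s m) (lastEntry w) v × AvoidsΛ (suc K) w × countBelow v w < K

  prefix? : ∀ s m v w → Dec (Prefix s m v w)
  prefix? s m v w = unique? w ×-dec (alternating? s w ×-dec (step? (stepAfter s m) (lastEntry w) v ×-dec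
                    (avoidsΛ? (suc K) w ×-dec (countBelow v w <? K))))

  𝟙-good-∷ʳ : ∀ s m v w → length w ≡ suc m →
              𝟙? (good? s (w ∷ʳ v)) ≡ 𝟙? (all? (λ y → ¬? (y ≟ v)) w) * 𝟙? (prefix? s m v w)
  𝟙-good-∷ʳ s m v (a ∷ r) len = trans (𝟙?-⇔ split (good? s ((a ∷ r) ∷ʳ v)) (all? (λ y → ¬? (y ≟ v)) (a ∷ r) ×-dec prefix? s m v (a ∷ r)))
                                      (𝟙?-× (all? (λ y → ¬? (y ≟ v)) (a ∷ r)) (prefix? s m v (a ∷ r)))
    where
    |r|≡m = suc-injective len
    split : Good s ((a ∷ r) ∷ʳ v) ⇔ (All (λ y → ¬ y ≡ v) (a ∷ r) × Prefix s m v (a ∷ r))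
    split = mk⇔
      (λ (!w∷ʳv , alt , avoids) →
        let (w∌v , !w) = to (Unique-∷ʳ (a ∷ r) v) !w∷ʳv
            (alt′ , w~v) = to (Alternating-∷ʳ s a r v) alt
            (avoids′ , c<K) = to (AvoidsΛ-∷ʳ K (a ∷ r) v) avoids
        in w∌v , !w , alt′ , subst (λ n → Step (stepAfter s n) (lastEntry (a ∷ r)) v) |r|≡m w~v , avoids′ , c<K)
      (λ (w∌v , !w , alt′ , w~v , avoids′ , c<K) →
        from (Unique-∷ʳ (a ∷ r) v) (w∌v , !w) ,
        from (Alternating-∷ʳ s a r v) (alt′ , subst (λ n → Step (stepAfter s n) (lastEntry (a ∷ r)) v) (sym |r|≡m) w~v) ,
        from (AvoidsΛ-∷ʳ K (a ∷ r) v) (avoids′ , c<K))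

  𝟙-prefix-skip : ∀ s m x u → length u ≡ suc m → All (λ y → 1 ≤ y × y < suc (suc m)) u → x ≤ suc m →
    𝟙? (prefix? s m (suc x) (map (skip (suc x)) u))
      ≡ 𝟙? (good? s u) * (𝟙? (codeStep? (stepAfter s m) (lastEntry u) (suc x)) * 𝟙? (x <? K))
  𝟙-prefix-skip s m x (a ∷ r) len bounds x≤1+m = begin
      𝟙? (prefix? s m v (map (skip v) u))
    ≡⟨ 𝟙?-⇔ standardize (prefix? s m v (map (skip v) u)) (good? s u ×-dec (codeStep? b (lastEntry u) v ×-dec (x <? K))) ⟩
      𝟙? (good? s u ×-dec (codeStep? b (lastEntry u) v ×-dec (x <? K)))
    ≡⟨ 𝟙?-× (good? s u) (codeStep? b (lastEntry u) v ×-dec (x <? K)) ⟩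
      𝟙? (good? s u) * 𝟙? (codeStep? b (lastEntry u) v ×-dec (x <? K))
    ≡⟨ cong (𝟙? (good? s u) *_) (𝟙?-× (codeStep? b (lastEntry u) v) (x <? K)) ⟩
      𝟙? (good? s u) * (𝟙? (codeStep? b (lastEntry u) v) * 𝟙? (x <? K))
    ∎
    where
    open ≡-Reasoning
    v = suc x
    u = a ∷ r
    b = stepAfter s m
    open Monotone (skip v) (skip-mono v)
    countBelow≡x : Unique u → countBelow v (map (skip v) u) ≡ x
    countBelow≡x !u = trans (countBelow-skip v u) (countBelow-permutation (suc m) u x !u bounds len x≤1+m)
    last-skip : lastEntry (map (skip v) u) ≡ skip v (lastEntry u)
    last-skip = lastEntry-map (skip v) a r
    standardize : Prefix s m v (map (skip v) u) ⇔ (Good s u × CodeStep b (lastEntry u) v × x < K)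
    standardize = mk⇔
      (λ (!u′ , alt , u~v , avoids , c<K) → let !u = to (Unique-map u) !u′ in
        (!u , to (Alternating-map s u) alt , avoids ∘ from (ContainsΛ-map (suc K) u)) ,
        to (Step-skip b (lastEntry u) v) (subst (λ z → Step b z v) last-skip u~v) ,
        subst (_< K) (countBelow≡x !u) c<K)
      (λ ((!u , alt , avoids) , u~v , x<K) →
        from (Unique-map u) !u , from (Alternating-map s u) alt ,
        subst (λ z → Step b z v) (sym last-skip) (from (Step-skip b (lastEntry u) v) u~v) ,
        avoids ∘ to (ContainsΛ-map (suc K) u) , subst (_< K) (sym (countBelow≡x !u)) x<K)

  -- Delete the last entry v = x + 1: the rest is map (skip v) u for a permutation u of
  -- {1, …, m + 1}, all conditions transfer along the increasing map skip v, and exactly x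
  -- entries of u lie below v.
  countEndingAt-standardize : ∀ s m x → x ≤ suc m →
    countEndingAt s (suc m) (suc x)
      ≡ sumOver (λ u → 𝟙? (good? s u) * (𝟙? (codeStep? (stepAfter s m) (lastEntry u) (suc x)) * 𝟙? (x <? K)))
                (words (suc m) (oneTo (suc m)))
  countEndingAt-standardize s m x x≤1+m = begin
      sumOver (λ w → 𝟙? (good? s (w ∷ʳ v))) (words (suc m) (oneTo (2 + m)))
    ≡⟨ sumOver-words-cong (λ _ → ⊤) (suc m) (oneTo (2 + m)) (All.universal (λ _ → tt) _) _ _ (λ w len _ → 𝟙-good-∷ʳ s m v w len) ⟩
      sumOver (λ w → 𝟙? (all? (λ y → ¬? (y ≟ v)) w) * 𝟙? (prefix? s m v w)) (words (suc m) (oneTo (2 + m)))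
    ≡⟨ sumOver-words-without (𝟙? ∘ prefix? s m v) v (suc m) (oneTo (2 + m)) ⟩
      sumOver (𝟙? ∘ prefix? s m v) (words (suc m) (without v (oneTo (2 + m))))
    ≡⟨ cong (λ L → sumOver (𝟙? ∘ prefix? s m v) (words (suc m) L)) alphabet ⟩
      sumOver (𝟙? ∘ prefix? s m v) (words (suc m) (map (skip v) (range 1 (suc m))))
    ≡⟨ sumOver-words-map (𝟙? ∘ prefix? s m v) (skip v) (suc m) (range 1 (suc m)) ⟩
      sumOver (𝟙? ∘ prefix? s m v ∘ map (skip v)) (words (suc m) (range 1 (suc m)))
    ≡⟨ sumOver-words-cong _ (suc m) (range 1 (suc m)) (range-All 1 (suc m)) _ _
                          (λ u len bounds → 𝟙-prefix-skip s m x u len bounds x≤1+m) ⟩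
      sumOver F (words (suc m) (range 1 (suc m)))
    ≡⟨ cong (λ L → sumOver F (words (suc m) L)) (oneTo≡range (suc m)) ⟨
      sumOver F (words (suc m) (oneTo (suc m)))
    ∎
    where
    open ≡-Reasoning
    v = suc x
    F : List ℕ → ℕ
    F u = 𝟙? (good? s u) * (𝟙? (codeStep? (stepAfter s m) (lastEntry u) v) * 𝟙? (x <? K))
    alphabet : without v (oneTo (2 + m)) ≡ map (skip v) (range 1 (suc m))
    alphabet = trans (cong (without v) (oneTo≡range (2 + m))) (without-range v 1 (suc m) (s≤s z≤n) (s≤s x≤1+m))

  sumOver-by-last : ∀ s m (c : ℕ → ℕ) →
    sumOver (λ u → 𝟙? (good? s u) * c (lastEntry u)) (words (suc m) (oneTo (suc m)))
      ≡ Σℕ (suc m) (λ i → countEndingAt s m (suc i) * c (suc i))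
  sumOver-by-last s m c = begin
      sumOver (λ u → 𝟙? (good? s u) * c (lastEntry u)) (words (suc m) (oneTo (suc m)))
    ≡⟨ sumOver-words-∷ʳ _ m (oneTo (suc m)) ⟩
      sumOver (λ y → sumOver (λ w → 𝟙? (good? s (w ∷ʳ y)) * c (lastEntry (w ∷ʳ y))) (words m (oneTo (suc m)))) (oneTo (suc m))
    ≡⟨ sumOver-cong (oneTo (suc m)) (λ y → trans (sumOver-cong (words m (oneTo (suc m))) (λ w → cong (λ z → 𝟙? (good? s (w ∷ʳ y)) * c z) (lastEntry-∷ʳ w y)))
                                                 (sumOver-*ʳ (c y) _ (words m (oneTo (suc m))))) ⟩
      sumOver (λ y → countEndingAt s m y * c y) (oneTo (suc m))
    ≡⟨ sumOver-applyUpTo (λ y → countEndingAt s m y * c y) suc (suc m) ⟩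
      Σℕ (suc m) (λ i → countEndingAt s m (suc i) * c (suc i))
    ∎
    where open ≡-Reasoning

  singleton-good : 0 < K → ∀ s v → Good s [ v ]
  singleton-good 0<K s v = [] ∷ [] , tt , from (AvoidsΛ-∷ʳ K [] v) ((λ { (here (() , _)) ; (there ()) }) , 0<K)

  countEndingAt≡ending : 0 < K → ∀ s m x → x < suc m → countEndingAt s m (suc x) ≡ ending K (not (stepAfter s m)) (suc m) x
  countEndingAt≡ending 0<K s zero    zero    _     = trans (cong (_+ 0) (𝟙?-yes (good? s [ 1 ]) (singleton-good 0<K s 1)))
                                                           (sym (allowed-yes K 1 z<s 0<K))
  countEndingAt≡ending 0<K s zero    (suc x) (s<s ())
  countEndingAt≡ending 0<K s (suc m) x       x<2+m = begin
      countEndingAt s (suc m) (suc x)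
    ≡⟨ countEndingAt-standardize s m x (≤-pred x<2+m) ⟩
      sumOver (λ u → 𝟙? (good? s u) * c (lastEntry u)) (words (suc m) (oneTo (suc m)))
    ≡⟨ sumOver-by-last s m c ⟩
      Σℕ (suc m) (λ i → countEndingAt s m (suc i) * c (suc i))
    ≡⟨ Σℕ-cong (suc m) (λ i i<1+m → cong₂ _*_ (countEndingAt≡ending 0<K s m i i<1+m) (cong (_* 𝟙? (x <? K)) (step-suc b i x))) ⟩
      Σℕ (suc m) (λ i → ending K (not b) (suc m) i * (step b i x * 𝟙? (x <? K)))
    ≡⟨ Σℕ-cong′ (suc m) (λ i → rotate (ending K (not b) (suc m) i) (step b i x) (𝟙? (x <? K))) ⟩
      Σℕ (suc m) (λ i → step b i x * ending K (not b) (suc m) i * 𝟙? (x <? K))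
    ≡⟨ Σℕ-*ʳ (suc m) (𝟙? (x <? K)) (λ i → step b i x * ending K (not b) (suc m) i) ⟩
      Σℕ (suc m) (λ i → step b i x * ending K (not b) (suc m) i) * 𝟙? (x <? K)
    ≡⟨ cong (_* 𝟙? (x <? K)) (Σℕ-range _ (λ i 1+m≤i → *-zeroʳ-≡ {step b i x} (ending-≥p K (not b) (suc m) 1+m≤i))
                                            (λ i K≤i → *-zeroʳ-≡ {step b i x} (ending-≥N K (not b) (suc m) K≤i))) ⟩
      Σℕ K (λ i → step b i x * ending K (not b) (suc m) i) * 𝟙? (x <? K)
    ≡⟨ *-comm _ (𝟙? (x <? K)) ⟩
      𝟙? (x <? K) * Σℕ K (λ i → step b i x * ending K (not b) (suc m) i)
    ≡⟨ cong (_* Σℕ K (λ i → step b i x * ending K (not b) (suc m) i)) (*-identityˡ-≡ (𝟙?-yes (x <? 2 + m) x<2+m)) ⟨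
      forward K (step b) (allowed K (2 + m)) (ending K (not b) (suc m)) x
    ≡⟨ cong (λ b′ → forward K (step b′) (allowed K (2 + m)) (ending K (not b′) (suc m)) x) (stepAfter-suc s m) ⟩
      ending K (not (stepAfter s (suc m))) (2 + m) x
    ∎
    where
    open ≡-Reasoning
    b = stepAfter s m
    c : ℕ → ℕ
    c y = 𝟙? (codeStep? b y (suc x)) * 𝟙? (x <? K)
    rotate : ∀ e r t → e * (r * t) ≡ r * e * t
    rotate = solve-∀

  count-0 : ∀ s → count s 0 ≡ 1
  count-0 s = cong (_+ 0) (𝟙?-yes (good? s []) ([] , tt , λ { (here (() , _)) ; (there ()) }))

  count≡codeCount : 0 < K → ∀ s m → count s (suc m) ≡ codeCount K (not (stepAfter s m)) (suc m)
  count≡codeCount 0<K s m = begin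
      count s (suc m)
    ≡⟨ count-suc s m ⟩
      Σℕ (suc m) (countEndingAt s m ∘ suc)
    ≡⟨ Σℕ-cong (suc m) (countEndingAt≡ending 0<K s m) ⟩
      Σℕ (suc m) (ending K (not (stepAfter s m)) (suc m))
    ≡⟨ Σℕ-range _ (λ i → ending-≥p K _ (suc m)) (λ i → ending-≥N K _ (suc m)) ⟩
      codeCount K (not (stepAfter s m)) (suc m)
    ∎
    where open ≡-Reasoning

-- Recurrences and the identity for sec + tan

even-recurrence : ∀ K n (e : ℕ → ℤ) → ⌊ K /2⌋ ≤ n →
  Σℤ (suc n) (λ i → sgn i *ℤ (binom K (2 * i) *ℤ e i)) ≡ 0ℤ →
  e 0 ≡ sumFromTo 1 ⌊ K /2⌋ (λ i → sgn (i + 1) *ℤ binom K (2 * i) *ℤ e i)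
even-recurrence K n e ⌊K/2⌋≤n Σ≡0 = begin
    e 0
  ≡⟨ ℤ.*-identityˡ (e 0) ⟨
    binom K 0 *ℤ e 0
  ≡⟨ x+y≡0⇒x≡-y (trans (cong (_+ℤ Σℤ n (T ∘ suc)) (sym (ℤ.*-identityˡ (binom K 0 *ℤ e 0)))) Σ≡0) ⟩
    - Σℤ n (T ∘ suc)
  ≡⟨ Σℤ-neg n (T ∘ suc) ⟩
    Σℤ n (λ i → - T (suc i))
  ≡⟨ Σℤ-cong n (λ i _ → negate (sgn (suc i)) (binom K (2 * suc i)) (e (suc i))) ⟩
    Σℤ n (λ i → - sgn (suc i) *ℤ binom K (2 * suc i) *ℤ e (suc i))
  ≡⟨ Σℤ-cong n (λ i _ → cong (λ s → s *ℤ binom K (2 * suc i) *ℤ e (suc i)) (trans (sym (sgn-suc (suc i))) (cong sgn (sym (+-comm (suc i) 1))))) ⟩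
    Σℤ n (F ∘ suc)
  ≡⟨ Σℤ-truncate (F ∘ suc) ⌊K/2⌋≤n (λ i ⌊K/2⌋≤i → vanish (suc i) (s≤s ⌊K/2⌋≤i)) ⟩
    Σℤ ⌊ K /2⌋ (F ∘ suc)
  ≡⟨ sumFromTo-1 ⌊ K /2⌋ F ⟨
    sumFromTo 1 ⌊ K /2⌋ F
  ∎
  where
  open ≡-Reasoning
  T F : ℕ → ℤ
  T i = sgn i *ℤ (binom K (2 * i) *ℤ e i)
  F i = sgn (i + 1) *ℤ binom K (2 * i) *ℤ e i
  x+y≡0⇒x≡-y : ∀ {x y} → x +ℤ y ≡ 0ℤ → x ≡ - y
  x+y≡0⇒x≡-y {x} {y} x+y≡0 = ∙-cancelʳ y x (- y) (trans x+y≡0 (sym (ℤ.+-inverseˡ y)))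
  negate : ∀ s b x → - (s *ℤ (b *ℤ x)) ≡ - s *ℤ b *ℤ x
  negate = ℤ-Solver.solve-∀
  vanish : ∀ i → ⌊ K /2⌋ < i → F i ≡ 0ℤ
  vanish i ⌊K/2⌋<i = trans (cong (λ c → sgn (i + 1) *ℤ c *ℤ e i) (binom-0 (⌊n/2⌋<i⇒n<2*i K i ⌊K/2⌋<i)))
                           (cong (_*ℤ e i) (ℤ.*-zeroʳ (sgn (i + 1))))

odd-recurrence : ∀ K n (e : ℕ → ℤ) → ⌊ K ∸ 1 /2⌋ ≤ n →
  Σℤ (suc n) (λ i → sgn i *ℤ (binom K (2 * i + 1) *ℤ e i)) ≡ sumFromTo 0 ⌊ K ∸ 1 /2⌋ (λ i → sgn i *ℤ binom K (2 * i + 1) *ℤ e i)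
odd-recurrence K n e ⌊K-1/2⌋≤n = begin
    Σℤ (suc n) (λ i → sgn i *ℤ (binom K (2 * i + 1) *ℤ e i))
  ≡⟨ Σℤ-cong (suc n) (λ i _ → ℤ.*-assoc (sgn i) (binom K (2 * i + 1)) (e i)) ⟨
    Σℤ (suc n) F
  ≡⟨ Σℤ-truncate F (s≤s ⌊K-1/2⌋≤n) vanish ⟩
    Σℤ (suc ⌊ K ∸ 1 /2⌋) F
  ≡⟨ sumFromTo-0 ⌊ K ∸ 1 /2⌋ F ⟨
    sumFromTo 0 ⌊ K ∸ 1 /2⌋ F
  ∎
  where
  open ≡-Reasoning
  F : ℕ → ℤ
  F i = sgn i *ℤ binom K (2 * i + 1) *ℤ e i
  K<2*i+1 : ∀ i → suc ⌊ K ∸ 1 /2⌋ ≤ i → K < 2 * i + 1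
  K<2*i+1 i ⌊K-1/2⌋<i = subst (K <_) (+-comm 1 (2 * i)) (s≤s (≤-trans (m≤1+m∸1 K) (⌊n/2⌋<i⇒n<2*i (K ∸ 1) i ⌊K-1/2⌋<i)))
    where
    m≤1+m∸1 : ∀ m → m ≤ suc (m ∸ 1)
    m≤1+m∸1 zero    = z≤n
    m≤1+m∸1 (suc m) = ≤-refl
  vanish : ∀ i → suc ⌊ K ∸ 1 /2⌋ ≤ i → F i ≡ 0ℤ
  vanish i ⌊K-1/2⌋<i = trans (cong (λ c → sgn i *ℤ c *ℤ e i) (binom-0 (K<2*i+1 i ⌊K-1/2⌋<i))) (cong (_*ℤ e i) (ℤ.*-zeroʳ (sgn i)))

sinPlusOne-even : ∀ M → 0 < M → sinPlusOne (2 * M) ≡ 0ℤ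
sinPlusOne-even (suc M) _ = trans (cong sinPlusOne (*-suc 2 M)) (even-coefficient M)
  where
  even-coefficient : ∀ M → sinPlusOne (2 + 2 * M) ≡ 0ℤ
  even-coefficient M with e ← trans (cong (_% 2) (*-comm 2 M)) (m*n%n≡0 M 2) rewrite e = refl

sinPlusOne-odd : ∀ M → sinPlusOne (suc (2 * M)) ≡ sgn M
sinPlusOne-odd zero    = refl
sinPlusOne-odd (suc M) = begin
    sinPlusOne (suc (2 * suc M))
  ≡⟨ cong (sinPlusOne ∘ suc) (*-suc 2 M) ⟩
    sinPlusOne (3 + 2 * M)
  ≡⟨ odd-coefficient M ⟩
    - sgn ⌊ suc (2 * M) /2⌋
  ≡⟨ cong (-_ ∘ sgn) (⌊1+2*n/2⌋≡n M) ⟩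
    - sgn M
  ≡⟨ sgn-suc M ⟨
    sgn (suc M)
  ∎
  where
  open ≡-Reasoning
  odd-coefficient : ∀ M → sinPlusOne (3 + 2 * M) ≡ - sgn ⌊ suc (2 * M) /2⌋
  odd-coefficient M with e ← trans (cong (λ n → suc n % 2) (*-comm 2 M)) ([m+kn]%n≡m%n 1 M 2) rewrite e = refl

SecTanAt : (ℕ → ℤ) → ℕ → Set
SecTanAt E m = sumFromTo 0 ⌊ m /2⌋ (λ j → sgn j *ℤ binom m (2 * j) *ℤ E (m ∸ 2 * j)) ≡ sinPlusOne m

secTan-unique : ∀ K (e f : ℕ → ℤ) → (∀ m → m ≤ K → SecTanAt e m) → (∀ m → m ≤ K → SecTanAt f m) →
                ∀ m → m ≤ K → e m ≡ f m
secTan-unique K e f e-secTan f-secTan = <-rec (λ m → m ≤ K → e m ≡ f m) induction-step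
  where
  G : (ℕ → ℤ) → ℕ → ℕ → ℤ
  G g m j = sgn j *ℤ binom m (2 * j) *ℤ g (m ∸ 2 * j)
  split : ∀ g m → sumFromTo 0 ⌊ m /2⌋ (G g m) ≡ g m +ℤ Σℤ ⌊ m /2⌋ (G g m ∘ suc)
  split g m = trans (sumFromTo-0 ⌊ m /2⌋ (G g m)) (cong (_+ℤ Σℤ ⌊ m /2⌋ (G g m ∘ suc)) (ℤ.*-identityˡ (g m)))
  induction-step : ∀ m → (∀ {m′} → m′ < m → m′ ≤ K → e m′ ≡ f m′) → m ≤ K → e m ≡ f m
  induction-step m e≡f<m m≤K = ∙-cancelʳ (Σℤ ⌊ m /2⌋ (G f m ∘ suc)) (e m) (f m) (begin
      e m +ℤ Σℤ ⌊ m /2⌋ (G f m ∘ suc)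
    ≡⟨ cong (e m +ℤ_) (Σℤ-cong ⌊ m /2⌋ (λ j j<⌊m/2⌋ → cong (sgn (suc j) *ℤ binom m (2 * suc j) *ℤ_) (sym (e≡f j j<⌊m/2⌋)))) ⟩
      e m +ℤ Σℤ ⌊ m /2⌋ (G e m ∘ suc)
    ≡⟨ trans (sym (split e m)) (e-secTan m m≤K) ⟩
      sinPlusOne m
    ≡⟨ trans (sym (f-secTan m m≤K)) (split f m) ⟩
      f m +ℤ Σℤ ⌊ m /2⌋ (G f m ∘ suc)
    ∎)
    where
    open ≡-Reasoning
    e≡f : ∀ j → j < ⌊ m /2⌋ → e (m ∸ 2 * suc j) ≡ f (m ∸ 2 * suc j)
    e≡f j j<⌊m/2⌋ = e≡f<m (∸-monoʳ-< {m} z<s (≤-trans (*-monoʳ-≤ 2 j<⌊m/2⌋) (2*⌊n/2⌋≤n m)))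
                          (≤-trans (m∸n≤m m (2 * suc j)) m≤K)

secTan-from-convolution : ∀ (e : ℕ → ℤ) m M → ⌊ m /2⌋ ≡ M →
  Σℤ (suc M) (λ i → sgn i *ℤ (binom m (2 * i) *ℤ e (m ∸ 2 * i))) ≡ sinPlusOne m → SecTanAt e m
secTan-from-convolution e m M ⌊m/2⌋≡M Σ≡sin = begin
    sumFromTo 0 ⌊ m /2⌋ F
  ≡⟨ sumFromTo-0 ⌊ m /2⌋ F ⟩
    Σℤ (suc ⌊ m /2⌋) F
  ≡⟨ cong (λ h → Σℤ (suc h) F) ⌊m/2⌋≡M ⟩
    Σℤ (suc M) F
  ≡⟨ Σℤ-cong (suc M) (λ i _ → ℤ.*-assoc (sgn i) (binom m (2 * i)) (e (m ∸ 2 * i))) ⟩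
    Σℤ (suc M) (λ i → sgn i *ℤ (binom m (2 * i) *ℤ e (m ∸ 2 * i)))
  ≡⟨ Σ≡sin ⟩
    sinPlusOne m
  ∎
  where
  open ≡-Reasoning
  F : ℕ → ℤ
  F j = sgn j *ℤ binom m (2 * j) *ℤ e (m ∸ 2 * j)

secTan-by-parity : ∀ K (e : ℕ → ℤ) → e 0 ≡ 1ℤ →
  (∀ M → 2 * suc M ≤ K → SecTanAt e (2 * suc M)) → (∀ M → suc (2 * M) ≤ K → SecTanAt e (suc (2 * M))) →
  ∀ m → m ≤ K → SecTanAt e m
secTan-by-parity K e e0≡1 even-case odd-case m m≤K with parityView m
... | even zero    = trans (ℤ.+-identityʳ _) (trans (ℤ.*-identityˡ (e 0)) e0≡1)
... | even (suc M) = even-case M m≤K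
... | odd  M       = odd-case M m≤K

module _ (K : ℕ) where

  ud du : ℕ → ℤ
  ud n = + countUD (suc K) n
  du n = + countDU (suc K) n

  countUD≡count : ∀ n → countUD (suc K) n ≡ count K true n
  countUD≡count n = trans (length-filter≡sumOver (goodUD? (suc K)) (words n (oneTo n)))
    (sumOver-cong (words n (oneTo n)) (λ π → 𝟙?-⇔ (mk⇔ (λ (!π , alt , avoids) → !π , subst (λ A → A) (sym (Alternating≡UpDown π)) alt , avoids)
                                      (λ (!π , alt , avoids) → !π , subst (λ A → A) (Alternating≡UpDown π) alt , avoids))
                                (goodUD? (suc K) π) (good? K true π)))

  countDU≡count : ∀ n → countDU (suc K) n ≡ count K false n
  countDU≡count n = trans (length-filter≡sumOver (goodDU? (suc K)) (words n (oneTo n)))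
    (sumOver-cong (words n (oneTo n)) (λ π → 𝟙?-⇔ (mk⇔ (λ (!π , alt , avoids) → !π , subst (λ A → A) (sym (Alternating≡DownUp π)) alt , avoids)
                                      (λ (!π , alt , avoids) → !π , subst (λ A → A) (Alternating≡DownUp π) alt , avoids))
                                (goodDU? (suc K) π) (good? K false π)))

  module _ (0<K : 0 < K) where

    count-even : ∀ s j → count K s (2 * j) ≡ codeCount K s (2 * j)
    count-even s zero    = count-0 K s
    count-even s (suc j) = begin
        count K s (2 * suc j)
      ≡⟨ cong (count K s) (*-suc 2 j) ⟩
        count K s (2 + 2 * j)
      ≡⟨ count≡codeCount K 0<K s (suc (2 * j)) ⟩
        codeCount K (not (stepAfter (not s) (2 * j))) (2 + 2 * j)
      ≡⟨ cong (λ b → codeCount K b (2 + 2 * j)) (trans (cong not (stepAfter-even (not s) j)) (not-involutive s)) ⟩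
        codeCount K s (2 + 2 * j)
      ≡⟨ cong (codeCount K s) (*-suc 2 j) ⟨
        codeCount K s (2 * suc j)
      ∎
      where open ≡-Reasoning

    count-odd : ∀ s j → count K s (suc (2 * j)) ≡ codeCount K (not s) (suc (2 * j))
    count-odd s j = trans (count≡codeCount K 0<K s (2 * j)) (cong (λ b → codeCount K (not b) (suc (2 * j))) (stepAfter-even s j))

    ud-even : ∀ j → ud (2 * j) ≡ + codeCount K true (2 * j)
    ud-even j = cong +_ (trans (countUD≡count (2 * j)) (count-even true j))

    ud-odd : ∀ j → ud (suc (2 * j)) ≡ + codeCount K false (suc (2 * j))
    ud-odd j = cong +_ (trans (countUD≡count (suc (2 * j))) (count-odd true j))

    du-even : ∀ j → du (2 * j) ≡ + codeCount K false (2 * j)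
    du-even j = cong +_ (trans (countDU≡count (2 * j)) (count-even false j))

    du-odd : ∀ j → du (suc (2 * j)) ≡ + codeCount K true (suc (2 * j))
    du-odd j = cong +_ (trans (countDU≡count (suc (2 * j))) (count-odd false j))

    ud-even-recurrence : ∀ n → suc K ≤ 2 * n →
      ud (2 * n) ≡ sumFromTo 1 ⌊ K /2⌋ (λ i → sgn (i + 1) *ℤ binom K (2 * i) *ℤ ud (2 * n ∸ 2 * i))
    ud-even-recurrence (suc n′) k≤2n = even-recurrence K n (λ i → ud (2 * n ∸ 2 * i)) ⌊K/2⌋≤n (begin
        Σℤ (suc n) (λ i → sgn i *ℤ (binom K (2 * i) *ℤ ud (2 * n ∸ 2 * i)))
      ≡⟨ binomial-convolution K true 0 0 n _ _ code run ⟩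
        0ℤ +ℤ sgn n *ℤ 0ℤ
      ≡⟨ x+s*0≡x 0ℤ (sgn n) ⟩
        0ℤ
      ∎)
      where
      open ≡-Reasoning
      n = suc n′
      K≤2n = ≤-trans (n≤1+n K) k≤2n
      ⌊K/2⌋≤n : ⌊ K /2⌋ ≤ n
      ⌊K/2⌋≤n = subst (⌊ K /2⌋ ≤_) (⌊2*n/2⌋≡n n) (⌊n/2⌋-mono K≤2n)
      code : ∀ i → i ≤ n → + codeCount K true (2 * (n ∸ i)) ≡ ud (2 * n ∸ 2 * i)
      code i _ = trans (sym (ud-even (n ∸ i))) (cong ud (2*[n∸i]≡2*n∸2*i n i))
      run : ∀ i → i ≤ n → runCount K true (suc (2 * (n ∸ i))) (2 * i) ≡ K C (2 * i)
      run i i≤n = trans (runCount-ascending-run-end-position K 0 0 n i i≤n) (cong (_C (2 * i)) (m≤n⇒m⊓n≡m K≤2n))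

    ud-odd-recurrence : ∀ n → suc K ≤ 2 * n + 1 →
      ud (2 * n + 1) ≡ sumFromTo 0 ⌊ K ∸ 1 /2⌋ (λ i → sgn i *ℤ binom K (2 * i + 1) *ℤ ud (2 * n ∸ 2 * i))
    ud-odd-recurrence n k≤2n+1 = begin
        ud (2 * n + 1)
      ≡⟨ trans (cong ud (+-comm (2 * n) 1)) (ud-odd n) ⟩
        + codeCount K false (suc (2 * n))
      ≡⟨ trans (cong +_ (sym (turning-1 K true (2 * n)))) (sym (x+s*0≡x _ (sgn n))) ⟩
        + turning K true (2 * n) 1 +ℤ sgn n *ℤ 0ℤ
      ≡⟨ binomial-convolution K true 0 1 n _ _ code run ⟨
        Σℤ (suc n) (λ i → sgn i *ℤ (binom K (2 * i + 1) *ℤ ud (2 * n ∸ 2 * i)))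
      ≡⟨ odd-recurrence K n (λ i → ud (2 * n ∸ 2 * i)) ⌊K-1/2⌋≤n ⟩
        sumFromTo 0 ⌊ K ∸ 1 /2⌋ (λ i → sgn i *ℤ binom K (2 * i + 1) *ℤ ud (2 * n ∸ 2 * i))
      ∎
      where
      open ≡-Reasoning
      K≤2n : K ≤ 2 * n
      K≤2n = ≤-pred (subst (suc K ≤_) (+-comm (2 * n) 1) k≤2n+1)
      ⌊K-1/2⌋≤n : ⌊ K ∸ 1 /2⌋ ≤ n
      ⌊K-1/2⌋≤n = subst (⌊ K ∸ 1 /2⌋ ≤_) (⌊2*n/2⌋≡n n) (⌊n/2⌋-mono (≤-trans (m∸n≤m K 1) K≤2n))
      code : ∀ i → i ≤ n → + codeCount K true (2 * (n ∸ i)) ≡ ud (2 * n ∸ 2 * i)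
      code i _ = trans (sym (ud-even (n ∸ i))) (cong ud (2*[n∸i]≡2*n∸2*i n i))
      run : ∀ i → i ≤ n → runCount K true (suc (2 * (n ∸ i))) (1 + 2 * i) ≡ K C (2 * i + 1)
      run i i≤n = trans (runCount-ascending-run-end-position K 0 1 n i i≤n)
                        (cong₂ _C_ (m≤n⇒m⊓n≡m (m≤n⇒m≤1+n K≤2n)) (+-comm 1 (2 * i)))

    du-even-recurrence : ∀ n → suc K ≤ 2 * n →
      du (2 * n) ≡ sumFromTo 0 ⌊ K ∸ 1 /2⌋ (λ i → sgn i *ℤ binom K (2 * i + 1) *ℤ du (2 * n ∸ 2 * i ∸ 1))
    du-even-recurrence (suc M) k≤2n = begin
        du (2 * suc M)
      ≡⟨ trans (du-even (suc M)) (cong (+_ ∘ codeCount K false) (*-suc 2 M)) ⟩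
        + codeCount K false (2 + 2 * M)
      ≡⟨ cong +_ (sym (turning-1 K true (suc (2 * M)))) ⟩
        + turning K true (suc (2 * M)) 1
      ≡⟨ sym (trans (cong (λ x → + turning K true (suc (2 * M)) 1 +ℤ sgn M *ℤ + x)
                          (straight-ascending-1-overflow K (2 * M) K≤1+2M))
                    (x+s*0≡x _ (sgn M))) ⟩
        + turning K true (1 + 2 * M) 1 +ℤ sgn M *ℤ + straight K true 1 (1 + 2 * M)
      ≡⟨ binomial-convolution K true 1 1 M _ _ code run ⟨
        Σℤ (suc M) (λ i → sgn i *ℤ (binom K (2 * i + 1) *ℤ du (2 * suc M ∸ 2 * i ∸ 1)))
      ≡⟨ odd-recurrence K M (λ i → du (2 * suc M ∸ 2 * i ∸ 1)) ⌊K-1/2⌋≤M ⟩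
        sumFromTo 0 ⌊ K ∸ 1 /2⌋ (λ i → sgn i *ℤ binom K (2 * i + 1) *ℤ du (2 * suc M ∸ 2 * i ∸ 1))
      ∎
      where
      open ≡-Reasoning
      K≤1+2M : K ≤ suc (2 * M)
      K≤1+2M = ≤-pred (subst (suc K ≤_) (*-suc 2 M) k≤2n)
      ⌊K-1/2⌋≤M : ⌊ K ∸ 1 /2⌋ ≤ M
      ⌊K-1/2⌋≤M = subst (⌊ K ∸ 1 /2⌋ ≤_) (⌊2*n/2⌋≡n M) (⌊n/2⌋-mono (∸-monoˡ-≤ 1 K≤1+2M))
      index : ∀ i → i ≤ M → suc (2 * (M ∸ i)) ≡ 2 * suc M ∸ 2 * i ∸ 1
      index i i≤M = begin
          suc (2 * (M ∸ i))
        ≡⟨ 1+2*[n∸i]≡1+2*n∸2*i M i i≤M ⟩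
          suc (2 * M) ∸ 2 * i
        ≡⟨ cong (_∸ 1) (+-∸-assoc 1 {suc (2 * M)} {2 * i} (m≤n⇒m≤1+n (*-monoʳ-≤ 2 i≤M))) ⟨
          2 + 2 * M ∸ 2 * i ∸ 1
        ≡⟨ cong (λ m → m ∸ 2 * i ∸ 1) (*-suc 2 M) ⟨
          2 * suc M ∸ 2 * i ∸ 1
        ∎
      code : ∀ i → i ≤ M → + codeCount K true (1 + 2 * (M ∸ i)) ≡ du (2 * suc M ∸ 2 * i ∸ 1)
      code i i≤M = trans (sym (du-odd (M ∸ i))) (cong du (index i i≤M))
      run : ∀ i → i ≤ M → runCount K true (suc (1 + 2 * (M ∸ i))) (1 + 2 * i) ≡ K C (2 * i + 1)
      run i i≤M = trans (runCount-ascending-run-end-position K 1 1 M i i≤M)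
                        (cong₂ _C_ (m≤n⇒m⊓n≡m (m≤n⇒m≤1+n K≤1+2M)) (+-comm 1 (2 * i)))

    du-odd-recurrence : ∀ n → suc K ≤ 2 * n + 1 →
      du (2 * n + 1) ≡ sumFromTo 1 ⌊ K /2⌋ (λ i → sgn (i + 1) *ℤ binom K (2 * i) *ℤ du (2 * n + 1 ∸ 2 * i))
    du-odd-recurrence zero     (s≤s K≤0)   = contradiction (≤-trans 0<K K≤0) λ ()
    du-odd-recurrence (suc n′) k≤2n+1 = even-recurrence K n (λ i → du (2 * n + 1 ∸ 2 * i)) ⌊K/2⌋≤n (begin
        Σℤ (suc n) (λ i → sgn i *ℤ (binom K (2 * i) *ℤ du (2 * n + 1 ∸ 2 * i)))
      ≡⟨ binomial-convolution K true 1 0 n _ _ code run ⟩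
        0ℤ +ℤ sgn n *ℤ + straight K true 1 (2 * n)
      ≡⟨ cong (λ x → 0ℤ +ℤ sgn n *ℤ + x) (straight-ascending-1-overflow K _ K≤2n) ⟩
        0ℤ +ℤ sgn n *ℤ 0ℤ
      ≡⟨ x+s*0≡x 0ℤ (sgn n) ⟩
        0ℤ
      ∎)
      where
      open ≡-Reasoning
      n = suc n′
      K≤2n : K ≤ 2 * n
      K≤2n = ≤-pred (subst (suc K ≤_) (+-comm (2 * n) 1) k≤2n+1)
      ⌊K/2⌋≤n : ⌊ K /2⌋ ≤ n
      ⌊K/2⌋≤n = subst (⌊ K /2⌋ ≤_) (⌊2*n/2⌋≡n n) (⌊n/2⌋-mono K≤2n)
      code : ∀ i → i ≤ n → + codeCount K true (1 + 2 * (n ∸ i)) ≡ du (2 * n + 1 ∸ 2 * i)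
      code i i≤n = trans (sym (du-odd (n ∸ i))) (cong du (trans (1+2*[n∸i]≡1+2*n∸2*i n i i≤n) (cong (_∸ 2 * i) (+-comm 1 (2 * n)))))
      run : ∀ i → i ≤ n → runCount K true (suc (1 + 2 * (n ∸ i))) (2 * i) ≡ K C (2 * i)
      run i i≤n = trans (runCount-ascending-run-end-position K 1 0 n i i≤n) (cong (_C (2 * i)) (m≤n⇒m⊓n≡m (m≤n⇒m≤1+n K≤2n)))

    ud-secTan-even : ∀ M → 2 * suc M ≤ K → SecTanAt ud (2 * suc M)
    ud-secTan-even M 2n≤K = secTan-from-convolution ud (2 * n) n (⌊2*n/2⌋≡n n) (begin
        Σℤ (suc n) (λ i → sgn i *ℤ (binom (2 * n) (2 * i) *ℤ ud (2 * n ∸ 2 * i)))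
      ≡⟨ binomial-convolution K true 0 0 n _ _ code run ⟩
        0ℤ +ℤ sgn n *ℤ 0ℤ
      ≡⟨ x+s*0≡x 0ℤ (sgn n) ⟩
        0ℤ
      ≡⟨ sinPlusOne-even n z<s ⟨
        sinPlusOne (2 * n)
      ∎)
      where
      open ≡-Reasoning
      n = suc M
      code : ∀ i → i ≤ n → + codeCount K true (2 * (n ∸ i)) ≡ ud (2 * n ∸ 2 * i)
      code i _ = trans (sym (ud-even (n ∸ i))) (cong ud (2*[n∸i]≡2*n∸2*i n i))
      run : ∀ i → i ≤ n → runCount K true (suc (2 * (n ∸ i))) (2 * i) ≡ (2 * n) C (2 * i)
      run i i≤n = trans (runCount-ascending-run-end-position K 0 0 n i i≤n) (cong (_C (2 * i)) (m≥n⇒m⊓n≡n 2n≤K))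

    ud-secTan-odd : ∀ M → suc (2 * M) ≤ K → SecTanAt ud (suc (2 * M))
    ud-secTan-odd M 1+2M≤K = secTan-from-convolution ud (suc (2 * M)) M (⌊1+2*n/2⌋≡n M) (begin
        Σℤ (suc M) (λ i → sgn i *ℤ (binom (suc (2 * M)) (2 * i) *ℤ ud (suc (2 * M) ∸ 2 * i)))
      ≡⟨ binomial-convolution K false 1 0 M _ _ code run ⟩
        0ℤ +ℤ sgn M *ℤ + straight K false 1 (2 * M)
      ≡⟨ cong (λ x → 0ℤ +ℤ sgn M *ℤ + x) (straight-descending-1 K (2 * M) 0<K) ⟩
        0ℤ +ℤ sgn M *ℤ 1ℤ
      ≡⟨ trans (ℤ.+-identityˡ _) (ℤ.*-identityʳ (sgn M)) ⟩
        sgn M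
      ≡⟨ sinPlusOne-odd M ⟨
        sinPlusOne (suc (2 * M))
      ∎)
      where
      open ≡-Reasoning
      code : ∀ i → i ≤ M → + codeCount K false (1 + 2 * (M ∸ i)) ≡ ud (suc (2 * M) ∸ 2 * i)
      code i i≤M = trans (sym (ud-odd (M ∸ i))) (cong ud (1+2*[n∸i]≡1+2*n∸2*i M i i≤M))
      run : ∀ i → i ≤ M → runCount K false (suc (1 + 2 * (M ∸ i))) (2 * i) ≡ suc (2 * M) C (2 * i)
      run i i≤M = runCount-descending-run-end-position K 1 0 M i i≤M
                    (λ 0<2i → ≤-trans (2+2*[n∸i]≤2*n M i 0<2i i≤M) (≤-trans (n≤1+n _) 1+2M≤K))

    ud-secTan : ∀ m → m ≤ K → SecTanAt ud m
    ud-secTan = secTan-by-parity K ud (cong +_ (countUD≡count 0)) ud-secTan-even ud-secTan-odd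

    du-secTan-even : ∀ M → 2 * suc M ≤ K → SecTanAt du (2 * suc M)
    du-secTan-even M 2n≤K = secTan-from-convolution du (2 * n) n (⌊2*n/2⌋≡n n) (begin
        Σℤ (suc n) (λ i → sgn i *ℤ (binom (2 * n) (2 * i) *ℤ du (2 * n ∸ 2 * i)))
      ≡⟨ binomial-convolution K false 0 0 n _ _ code run ⟩
        0ℤ +ℤ sgn n *ℤ 0ℤ
      ≡⟨ x+s*0≡x 0ℤ (sgn n) ⟩
        0ℤ
      ≡⟨ sinPlusOne-even n z<s ⟨
        sinPlusOne (2 * n)
      ∎)
      where
      open ≡-Reasoning
      n = suc M
      code : ∀ i → i ≤ n → + codeCount K false (2 * (n ∸ i)) ≡ du (2 * n ∸ 2 * i)
      code i _ = trans (sym (du-even (n ∸ i))) (cong du (2*[n∸i]≡2*n∸2*i n i))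
      run : ∀ i → i ≤ n → runCount K false (suc (2 * (n ∸ i))) (2 * i) ≡ (2 * n) C (2 * i)
      run i i≤n = runCount-descending-run-end-position K 0 0 n i i≤n
                    (λ 0<2i → ≤-trans (n≤1+n _) (≤-trans (2+2*[n∸i]≤2*n n i 0<2i i≤n) 2n≤K))

    du-secTan-odd : ∀ M → suc (2 * M) ≤ K → SecTanAt du (suc (2 * M))
    du-secTan-odd M 1+2M≤K = secTan-from-convolution du (suc (2 * M)) M (⌊1+2*n/2⌋≡n M) (begin
        Σℤ (suc M) (λ i → sgn i *ℤ (binom (suc (2 * M)) (2 * i) *ℤ du (suc (2 * M) ∸ 2 * i)))
      ≡⟨ binomial-convolution K true 1 0 M _ _ code run ⟩
        0ℤ +ℤ sgn M *ℤ + straight K true 1 (2 * M)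
      ≡⟨ cong (λ x → 0ℤ +ℤ sgn M *ℤ + x) (straight-ascending-1 K (2 * M) 1+2M≤K) ⟩
        0ℤ +ℤ sgn M *ℤ 1ℤ
      ≡⟨ trans (ℤ.+-identityˡ _) (ℤ.*-identityʳ (sgn M)) ⟩
        sgn M
      ≡⟨ sinPlusOne-odd M ⟨
        sinPlusOne (suc (2 * M))
      ∎)
      where
      open ≡-Reasoning
      code : ∀ i → i ≤ M → + codeCount K true (1 + 2 * (M ∸ i)) ≡ du (suc (2 * M) ∸ 2 * i)
      code i i≤M = trans (sym (du-odd (M ∸ i))) (cong du (1+2*[n∸i]≡1+2*n∸2*i M i i≤M))
      run : ∀ i → i ≤ M → runCount K true (suc (1 + 2 * (M ∸ i))) (2 * i) ≡ suc (2 * M) C (2 * i)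
      run i i≤M = trans (runCount-ascending-run-end-position K 1 0 M i i≤M) (cong (_C (2 * i)) (m≥n⇒m⊓n≡n 1+2M≤K))

    du-secTan : ∀ m → m ≤ K → SecTanAt du m
    du-secTan = secTan-by-parity K du (cong +_ (countDU≡count 0)) du-secTan-even du-secTan-odd

theorem4 : (k : ℕ) → 3 ≤ k → (E : ℕ → ℤ) → IsSecTanEGF E →
    ((m : ℕ) → m < k → (+ countUD k m ≡ E m) × (+ countDU k m ≡ E m))
    × ((n : ℕ) → k ≤ 2 * n →
        + countUD k (2 * n)
          ≡ sumFromTo 1 ⌊ k ∸ 1 /2⌋ (λ i → sgn (i + 1) *ℤ binom (k ∸ 1) (2 * i) *ℤ + countUD k (2 * n ∸ 2 * i)))
    × ((n : ℕ) → k ≤ 2 * n + 1 →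
        + countUD k (2 * n + 1)
          ≡ sumFromTo 0 ⌊ k ∸ 2 /2⌋ (λ i → sgn i *ℤ binom (k ∸ 1) (2 * i + 1) *ℤ + countUD k (2 * n ∸ 2 * i)))
    × ((n : ℕ) → k ≤ 2 * n →
        + countDU k (2 * n)
          ≡ sumFromTo 0 ⌊ k ∸ 2 /2⌋ (λ i → sgn i *ℤ binom (k ∸ 1) (2 * i + 1) *ℤ + countDU k (2 * n ∸ 2 * i ∸ 1)))
    × ((n : ℕ) → k ≤ 2 * n + 1 →
        + countDU k (2 * n + 1)
          ≡ sumFromTo 1 ⌊ k ∸ 1 /2⌋ (λ i → sgn (i + 1) *ℤ binom (k ∸ 1) (2 * i) *ℤ + countDU k (2 * n + 1 ∸ 2 * i)))
theorem4 (suc K) (s≤s 2≤K) E E-secTan =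
  (λ m m<k → secTan-unique K (ud K) E (ud-secTan K 0<K) (λ m _ → E-secTan m) m (≤-pred m<k)
           , secTan-unique K (du K) E (du-secTan K 0<K) (λ m _ → E-secTan m) m (≤-pred m<k))
  , ud-even-recurrence K 0<K
  , ud-odd-recurrence K 0<K
  , du-even-recurrence K 0<K
  , du-odd-recurrence K 0<K
  where
  0<K : 0 < K
  0<K = ≤-trans (s≤s z≤n) 2≤K
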